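{- Let $\mathcal{C} = \bigcup_{T\in\binom{Z}{3}}\mathcal{B}^{\bigcirc}(T)$. If a graph $L$ on the vertex set $Z$ is triangle-decomposable, then $L\cup\bigcirc_gZ$ has a triangle-decomposition using only triangles of $\mathcal C$, with girth greater than $g$.
   Context: Fix an integer $g>2$ and a vertex set $Z$. The $g$-sphere-cover of $Z$ is the graph $\bigcirc_gZ$ obtained as follows. For every triple $T$ of distinct vertices of $Z$, arbitrarily label these vertices as $a,b_1,b_2$, and append a ``$g$-sphere'': add $2g-1$ new vertices $b_3,\ldots,b_{2g},c$ (new for each triple), then add the edges $ab_j$ for $3\le j\le 2g$, the edges $cb_j$ for $1\le j\le 2g$, the edges $b_jb_{j+1}$ for $2\le j\le 2g-1$, and the edge $b_{2g}b_1$. The out-decomposition of this $g$-sphere consists of the triangles $c b_2 b_3,\,ab_3 b_4,\, c b_4b_5,\, a b_5 b_6,\dots,cb_{2g}b_1$; the in-decomposition (a triangle-decomposition of the $g$-sphere together with the edges of $T$) consists of the triangles $cb_1b_2,\,ab_2b_3,\,cb_3b_4,\,a b_4 b_5,\dots,ab_{2g}b_1$. $\mathcal{B}^{\bigcirc}(T)$ denotes the set of all triangles in the in- and out-decompositions of the $g$-sphere associated to $T$ (note $T\notin\mathcal{B}^{\bigcirc}(T)$). The girth of a set of triangles (triple system) is the smallest $j\ge 4$ for which some $j$ vertices span at least $j-2$ triangles (infinite if none). -}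

module Defs where

open import Data.Nat using (ℕ; suc; _+_; _*_; _∸_; _≤_)
open import Data.Fin using (Fin; toℕ)
import Data.Fin as F
open import Data.Product using (Σ; _×_; _,_; proj₁)
open import Data.Sum using (_⊎_)
open import Data.Empty using (⊥)
open import Data.List using (List; length; lookup)
open import Data.List.Membership.Propositional using (_∈_)
open import Data.List.Relation.Unary.All using (All)
open import Data.List.Relation.Unary.Unique.Propositional using (Unique)
open import Relation.Nullary using (¬_)
open import Relation.Binary.PropositionalEquality using (_≡_; _≢_)

record SimpleGraph (V : Set) : Set₁ where
  field
    Adj    : V → V → Set
    sym    : ∀ {x y} → Adj x y → Adj y x
    irrefl : ∀ {x} → ¬ Adj x x

-- a triangle is given by its three vertices (as an unordered set)
Tri : Set → Set
Tri V = V × V × V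

_∈T_ : {V : Set} → V → Tri V → Set
w ∈T (x , y , z) = w ≡ x ⊎ w ≡ y ⊎ w ≡ z

EdgeIn : {V : Set} → V → V → Tri V → Set
EdgeIn u v t = u ∈T t × v ∈T t

IsTriangleDecomposition : {V : Set} → (V → V → Set) → List (Tri V) → Set
IsTriangleDecomposition {V} E D =
  All (λ { (x , y , z) → (x ≢ y × y ≢ z × x ≢ z) × (E x y × E y z × E x z) }) D
  × (∀ (u v : V) → E u v →
       Σ (Fin (length D)) (λ i → EdgeIn u v (lookup D i))
       × (∀ i j → EdgeIn u v (lookup D i) → EdgeIn u v (lookup D j) → i ≡ j))

TriangleDecomposable : {V : Set} → (V → V → Set) → Set
TriangleDecomposable {V} E = Σ (List (Tri V)) (IsTriangleDecomposition E)

_⊆T_ : {V : Set} → Tri V → List V → Set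
(x , y , z) ⊆T S = x ∈ S × y ∈ S × z ∈ S

GirthGreaterThan : {V : Set} → ℕ → List (Tri V) → Set
GirthGreaterThan {V} g D =
  ∀ (S : List V) → Unique S → 4 ≤ length S → length S ≤ g →
  ∀ (I : List (Fin (length D))) → Unique I → length S ≤ length I + 2 →
  All (λ i → lookup D i ⊆T S) I → ⊥

-- 3-element subsets of Fin n, represented as sorted triples x < y < z
Triple : ℕ → Set
Triple n = Σ (Fin n × Fin n × Fin n) (λ { (x , y , z) → x F.< y × y F.< z })

-- (a , b₁ , b₂) is a labelling of the vertex set {x, y, z}
data IsLabelling {n : ℕ} : Fin n × Fin n × Fin n → Fin n × Fin n × Fin n → Set where
  lab-xyz : ∀ {x y z} → IsLabelling (x , y , z) (x , y , z)
  lab-xzy : ∀ {x y z} → IsLabelling (x , y , z) (x , z , y)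
  lab-yxz : ∀ {x y z} → IsLabelling (x , y , z) (y , x , z)
  lab-yzx : ∀ {x y z} → IsLabelling (x , y , z) (y , z , x)
  lab-zxy : ∀ {x y z} → IsLabelling (x , y , z) (z , x , y)
  lab-zyx : ∀ {x y z} → IsLabelling (x , y , z) (z , y , x)

-- vertices of Z ∪ ○_g Z: the old vertices of Z, and for each triple T
-- the new vertices b₃,…,b_{2g} (bnew T k is b_{3+k}) and c (cnew T).
data V (n g : ℕ) : Set where
  old  : Fin n → V n g
  bnew : Triple n → Fin (2 * g ∸ 2) → V n g
  cnew : Triple n → V n g

module Sphere (n g : ℕ) (lab : Triple n → Fin n × Fin n × Fin n) where

  aOf : Triple n → Fin n
  aOf T = proj₁ (lab T)

  b₁Of : Triple n → Fin n
  b₁Of T = proj₁ (Data.Product.proj₂ (lab T))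

  b₂Of : Triple n → Fin n
  b₂Of T = Data.Product.proj₂ (Data.Product.proj₂ (lab T))

  aV : Triple n → V n g
  aV T = old (aOf T)

  cV : Triple n → V n g
  cV T = cnew T

  -- IsB T j v : v is the vertex b_j of the g-sphere of T (1 ≤ j ≤ 2g)
  data IsB (T : Triple n) : ℕ → V n g → Set where
    isB₁ : IsB T 1 (old (b₁Of T))
    isB₂ : IsB T 2 (old (b₂Of T))
    isBₖ : (k : Fin (2 * g ∸ 2)) → IsB T (3 + toℕ k) (bnew T k)

  -- edges of ○_g Z (one orientation)
  data SphereEdge : V n g → V n g → Set where
    e-ab : ∀ {T j v} → 3 ≤ j → IsB T j v → SphereEdge (aV T) v
    e-cb : ∀ {T j v} → IsB T j v → SphereEdge (cV T) v
    e-bb : ∀ {T j u v} → 2 ≤ j → IsB T j u → IsB T (suc j) v → SphereEdge u v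
    e-wrap : ∀ {T u v} → IsB T (2 * g) u → IsB T 1 v → SphereEdge u v

  LiftL : (Fin n → Fin n → Set) → V n g → V n g → Set
  LiftL L (old x) (old y) = L x y
  LiftL L _ _ = ⊥

  UnionE : SimpleGraph (Fin n) → V n g → V n g → Set
  UnionE L u v = LiftL (SimpleGraph.Adj L) u v ⊎ SphereEdge u v ⊎ SphereEdge v u

  -- 𝓑^○(T): triangles of the out-decomposition
  -- (c b₂ b₃, a b₃ b₄, c b₄ b₅, …, c b_{2g} b₁) and of the in-decomposition
  -- (c b₁ b₂, a b₂ b₃, c b₃ b₄, …, a b_{2g} b₁)
  data InB (T : Triple n) : Tri (V n g) → Set where
    out-c : ∀ {k u v} → 1 ≤ k → IsB T (2 * k) u → IsB T (suc (2 * k)) v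
            → InB T (cV T , u , v)
    out-a : ∀ {k u v} → 1 ≤ k → IsB T (suc (2 * k)) u → IsB T (2 + 2 * k) v
            → InB T (aV T , u , v)
    out-wrap : ∀ {u v} → IsB T (2 * g) u → IsB T 1 v → InB T (cV T , u , v)
    in-c : ∀ {k u v} → IsB T (suc (2 * k)) u → IsB T (2 + 2 * k) v
           → InB T (cV T , u , v)
    in-a : ∀ {k u v} → 1 ≤ k → IsB T (2 * k) u → IsB T (suc (2 * k)) v
           → InB T (aV T , u , v)
    in-wrap : ∀ {u v} → IsB T (2 * g) u → IsB T 1 v → InB T (aV T , u , v)

  InC : Tri (V n g) → Set
  InC t = Σ (Triple n) λ T → Σ (Tri (V n g)) λ t' →
            InB T t' × (∀ w → (w ∈T t → w ∈T t') × (w ∈T t' → w ∈T t))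

-- Give the g-sphere of a triple T its in-decomposition if T is a triangle of the decomposition
-- of L, and its out-decomposition otherwise: the in-decompositions also cover the edges of L.
-- Two chosen triangles sharing two vertices coincide, because a new vertex belongs to one sphere,
-- two shared vertices of Z force both spheres to be triangles of L sharing an edge, and the
-- triangles of one decomposition of a sphere are edge-disjoint.
-- For the girth, k ≥ 2 triangles of one sphere lying in a set S of at most g vertices span at
-- least k + 3 of them: their vertices b_{p+2} are distinct, and either all positions p have one
-- parity (add their common apex and two vertices b_{p+1}), or both apices occur and the positions
-- cannot fill the whole 2g-cycle (add the first vertex of an arc of positions). Triangles on
-- different spheres meet only in vertices of Z, at most two for a single triangle, three for a
-- sphere and one for two single triangles, so merging the spheres one at a time keeps the bound
-- k + 3 ≤ |S|, which contradicts |S| ≤ k + 2.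

module Submission where

open import Defs
open import Data.Nat using (ℕ; zero; suc; pred; _+_; _*_; _∸_; _≤_; _<_; z≤n; s≤s; _≤?_; _<?_)
open import Data.Nat.Properties
  using (≤-refl; ≤-trans; ≤-reflexive; ≤-antisym; ≤-total; ≤-irrelevant; ≤-pred; <-irrefl; <-trans; <⇒≤; <⇒≢; <⇒≱;
         ≰⇒>; ≮⇒≥; <⇒≤pred; n<1+n; m<m+n; suc-injective; +-suc; +-comm; +-assoc; +-identityʳ;
         +-mono-≤; +-monoʳ-≤; +-cancelʳ-≤; +-cancelˡ-≤; m∸n+n≡m)
import Data.Nat.Properties as ℕ
open import Data.Nat.Solver using (module +-*-Solver)
open import Data.Fin using (Fin; toℕ; fromℕ<)
import Data.Fin as F
open import Data.Fin.Properties using (pigeonhole; toℕ-fromℕ<; fromℕ<-toℕ; toℕ<n; toℕ-injective; <-cmp)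
open import Data.Bool using (Bool; true; false; not; if_then_else_)
import Data.Bool as Bool
open import Data.Bool.Properties using (not-injective; not-¬)
open import Data.Unit using (⊤; tt)
open import Data.Empty using (⊥; ⊥-elim)
open import Data.Product using (Σ; ∃; _×_; _,_; proj₁; proj₂; map₂)
open import Data.Product.Properties using (×-≡,≡→≡)
open import Data.Sum using (_⊎_; inj₁; inj₂; [_,_]′)
open import Data.Maybe using (Maybe; just; nothing)
open import Data.Maybe.Properties using (just-injective)
open import Data.List using (List; []; _∷_; length; lookup; map; filter; _++_; upTo; cartesianProduct; allFin)
open import Data.List.Properties using (length-++; length-map; length-upTo; filter-notAll; filter-none; filter-all)
open import Data.List.Membership.Propositional using (_∈_; _∉_; find; lose)
open import Data.List.Membership.Propositional.Properties
  using (∈-lookup; ∈-++⁻; ∈-filter⁺; ∈-filter⁻; ∈-map⁺; ∈-map⁻; ∈-upTo⁺; ∈-upTo⁻; ∈-cartesianProduct⁺; ∈-allFin)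
open import Data.List.Relation.Unary.Any as Any using (Any; here; there; index)
open import Data.List.Relation.Unary.Any.Properties using (lookup-index)
open import Data.List.Relation.Unary.All as All using (All; []; _∷_; all?)
open import Data.List.Relation.Unary.All.Properties using (map⁺; ¬All⇒Any¬)
open import Data.List.Relation.Unary.AllPairs using ([]; _∷_)
open import Data.List.Relation.Unary.Unique.Propositional using (Unique)
open import Data.List.Relation.Unary.Unique.Propositional.Properties using (filter⁺; ++⁺; cartesianProduct⁺; allFin⁺; upTo⁺)
open import Data.List.Relation.Binary.Subset.Propositional using (_⊆_)
open import Function using (case_of_)
open import Relation.Nullary using (¬_; Dec; yes; no; does; _×-dec_; _→-dec_)
open import Relation.Nullary.Decidable using (dec-true)
open import Relation.Unary using (Decidable)
open import Relation.Unary.Properties using (∁?)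
open import Relation.Binary.Definitions using (DecidableEquality; tri<; tri≈; tri>)
open import Relation.Binary.PropositionalEquality
  using (_≡_; _≢_; refl; sym; trans; cong; cong₂; subst; subst₂; module ≡-Reasoning)

private variable
  A B : Set
  xs ys : List A

unique-map⁺ : (f : A → B) → (∀ {x y} → x ∈ xs → y ∈ xs → f x ≡ f y → x ≡ y) →
              Unique xs → Unique (map f xs)
unique-map⁺ {xs = []} f inj [] = []
unique-map⁺ {xs = x ∷ xs} f inj (x∉xs ∷ u) =
  map⁺ (All.tabulate λ y∈xs fx≡fy → All.lookup x∉xs y∈xs (inj (here refl) (there y∈xs) fx≡fy))
  ∷ unique-map⁺ f (λ x∈ y∈ → inj (there x∈) (there y∈)) u

unique-lookup-injective : Unique xs → ∀ i j → lookup xs i ≡ lookup xs j → i ≡ j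
unique-lookup-injective {xs = _ ∷ _} _ F.zero F.zero _ = refl
unique-lookup-injective {xs = _ ∷ _} (x∉xs ∷ _) F.zero (F.suc j) eq = ⊥-elim (All.lookup x∉xs (∈-lookup j) eq)
unique-lookup-injective {xs = _ ∷ _} (x∉xs ∷ _) (F.suc i) F.zero eq = ⊥-elim (All.lookup x∉xs (∈-lookup i) (sym eq))
unique-lookup-injective {xs = _ ∷ _} (_ ∷ u) (F.suc i) (F.suc j) eq = cong F.suc (unique-lookup-injective u i j eq)

unique-⊆⇒length-≤ : Unique xs → xs ⊆ ys → length xs ≤ length ys
unique-⊆⇒length-≤ {xs = xs} {ys} u xs⊆ys with length xs ≤? length ys
... | yes le = le
... | no gt with pigeonhole (≰⇒> gt) (λ i → index (xs⊆ys (∈-lookup i)))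
...   | i , j , i<j , same =
  ⊥-elim (<⇒≢ i<j (cong F.toℕ (unique-lookup-injective u i j
    (trans (lookup-index (xs⊆ys (∈-lookup i)))
           (trans (cong (lookup ys) same) (sym (lookup-index (xs⊆ys (∈-lookup j)))))))))

unique-distinct-pair : Unique xs → 2 ≤ length xs → Σ A λ a → Σ A λ b → a ∈ xs × b ∈ xs × a ≢ b
unique-distinct-pair {xs = _ ∷ []} _ (s≤s ())
unique-distinct-pair {xs = a ∷ b ∷ _} ((a≢b ∷ _) ∷ _) _ = a , b , here refl , there (here refl) , a≢b

module _ {P : A → Set} (P? : Decidable P) where

  length-filter-∁ : ∀ xs → length xs ≡ length (filter P? xs) + length (filter (∁? P?) xs)
  length-filter-∁ [] = refl
  length-filter-∁ (x ∷ xs) with P? x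
  ... | yes _ = cong suc (length-filter-∁ xs)
  ... | no _ = trans (cong suc (length-filter-∁ xs)) (sym (+-suc _ _))

length-filter-⊎ : {P Q R : A → Set} (P? : Decidable P) (Q? : Decidable Q) (R? : Decidable R) →
  (∀ {x} → R x → P x ⊎ Q x) → (∀ {x} → P x → R x) → (∀ {x} → Q x → R x) → (∀ {x} → P x → ¬ Q x) →
  ∀ xs → length (filter R? xs) ≡ length (filter P? xs) + length (filter Q? xs)
length-filter-⊎ P? Q? R? R⇒P⊎Q P⇒R Q⇒R P⇒¬Q [] = refl
length-filter-⊎ P? Q? R? R⇒P⊎Q P⇒R Q⇒R P⇒¬Q (x ∷ xs) with R? x | P? x | Q? x
... | yes _ | yes p | yes q = ⊥-elim (P⇒¬Q p q)
... | yes _ | yes _ | no _ = cong suc (length-filter-⊎ P? Q? R? R⇒P⊎Q P⇒R Q⇒R P⇒¬Q xs)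
... | yes _ | no _ | yes _ = trans (cong suc (length-filter-⊎ P? Q? R? R⇒P⊎Q P⇒R Q⇒R P⇒¬Q xs)) (sym (+-suc _ _))
... | yes r | no ¬p | no ¬q = ⊥-elim ([ ¬p , ¬q ]′ (R⇒P⊎Q r))
... | no ¬r | yes p | _ = ⊥-elim (¬r (P⇒R p))
... | no ¬r | no _ | yes q = ⊥-elim (¬r (Q⇒R q))
... | no _ | no _ | no _ = length-filter-⊎ P? Q? R? R⇒P⊎Q P⇒R Q⇒R P⇒¬Q xs

module Union {A : Set} (_≟_ : DecidableEquality A) where

  open import Data.List.Membership.DecPropositional _≟_ using (_∈?_)

  common : List A → List A → List A
  common W X = filter (_∈? W) X

  infixr 5 _∪_
  _∪_ : List A → List A → List A
  W ∪ X = W ++ filter (∁? (_∈? W)) X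

  ∪-unique : ∀ {W X} → Unique W → Unique X → Unique (W ∪ X)
  ∪-unique {W} {X} uW uX =
    ++⁺ uW (filter⁺ (∁? (_∈? W)) uX) λ (w∈W , w∈X') → proj₂ (∈-filter⁻ (∁? (_∈? W)) {xs = X} w∈X') w∈W

  ∈-∪⁻ : ∀ W {X w} → w ∈ W ∪ X → w ∈ W ⊎ w ∈ X
  ∈-∪⁻ W {X} w∈ with ∈-++⁻ W w∈
  ... | inj₁ w∈W = inj₁ w∈W
  ... | inj₂ w∈X' = inj₂ (proj₁ (∈-filter⁻ (∁? (_∈? W)) {xs = X} w∈X'))

  length-∪ : ∀ W X → length W + length X ≡ length (W ∪ X) + length (common W X)
  length-∪ W X = begin
    length W + length X                          ≡⟨ cong (length W +_) (length-filter-∁ (_∈? W) X) ⟩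
    length W + (length (common W X) + length X') ≡⟨ cong (length W +_) (+-comm (length (common W X)) _) ⟩
    length W + (length X' + length (common W X)) ≡⟨ +-assoc (length W) _ _ ⟨
    length W + length X' + length (common W X)   ≡⟨ cong (_+ length (common W X)) (length-++ W) ⟨
    length (W ∪ X) + length (common W X)         ∎
    where
    open ≡-Reasoning
    X' = filter (∁? (_∈? W)) X

  length-∪-≥ : ∀ W X {c} → length (common W X) ≤ c → length W + length X ≤ length (W ∪ X) + c
  length-∪-≥ W X c≥ = ≤-trans (≤-reflexive (length-∪ W X)) (+-monoʳ-≤ (length (W ∪ X)) c≥)

  length-∪-bound : ∀ {k k' e e' c} W X → k + e ≤ length W → k' + e' ≤ length X →
    length (common W X) ≤ c → c + 3 ≤ e + e' → k' + k + 3 ≤ length (W ∪ X)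
  length-∪-bound {k} {k'} {e} {e'} {c} W X kW k'X common≤c c+3≤ =
    +-cancelʳ-≤ c (k' + k + 3) (length (W ∪ X)) (begin
      k' + k + 3 + c       ≡⟨ solve 3 (λ k k' c → k' :+ k :+ con 3 :+ c := k :+ k' :+ (c :+ con 3)) refl k k' c ⟩
      k + k' + (c + 3)     ≤⟨ +-monoʳ-≤ (k + k') c+3≤ ⟩
      k + k' + (e + e')    ≡⟨ solve 4 (λ k k' e e' → k :+ k' :+ (e :+ e') := (k :+ e) :+ (k' :+ e')) refl k k' e e' ⟩
      (k + e) + (k' + e')  ≤⟨ +-mono-≤ kW k'X ⟩
      length W + length X  ≤⟨ length-∪-≥ W X common≤c ⟩
      length (W ∪ X) + c   ∎)
    where
    open ℕ.≤-Reasoning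
    open +-*-Solver using (solve; _:=_; _:+_; con)

length-cases : (xs : List A) → length xs ≡ 0 ⊎ Σ A (λ x → x ∈ xs × length xs ≡ 1) ⊎ 2 ≤ length xs
length-cases [] = inj₁ refl
length-cases (x ∷ []) = inj₂ (inj₁ (x , here refl , refl))
length-cases (_ ∷ _ ∷ _) = inj₂ (inj₂ (s≤s (s≤s z≤n)))

ev : ℕ → Bool
ev zero = true
ev (suc n) = not (ev n)

ev-double : ∀ m → ev (m + m) ≡ true
ev-double zero = refl
ev-double (suc m) rewrite +-suc m m | ev-double m = refl

parity : ∀ p → ∃ λ k → (p ≡ k + k × ev p ≡ true) ⊎ (p ≡ suc (k + k) × ev p ≡ false)
parity zero = 0 , inj₁ (refl , refl)
parity (suc p) with parity p
... | k , inj₁ (refl , e) = k , inj₂ (refl , cong not e)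
... | k , inj₂ (refl , e) = suc k , inj₁ (cong suc (sym (+-suc k k)) , cong not e)

module EvenCycle (k : ℕ) where

  open import Data.List.Membership.DecPropositional ℕ._≟_ using (_∈?_)

  N : ℕ
  N = 2 * suc (suc k)

  ev-N : ev N ≡ true
  ev-N rewrite +-identityʳ (suc (suc k)) = ev-double (suc (suc k))

  next : ℕ → ℕ
  next p with suc p <? N
  ... | yes _ = suc p
  ... | no _ = 0

  prev : ℕ → ℕ
  prev zero = pred N
  prev (suc p) = p

  next-suc : ∀ {p} → suc p < N → next p ≡ suc p
  next-suc {p} lt with suc p <? N
  ... | yes _ = refl
  ... | no ¬lt = ⊥-elim (¬lt lt)

  next-last : ∀ {p} → suc p ≡ N → next p ≡ 0
  next-last {p} eq with suc p <? N
  ... | yes lt = ⊥-elim (<-irrefl eq lt)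
  ... | no _ = refl

  next<N : ∀ p → next p < N
  next<N p with suc p <? N
  ... | yes lt = lt
  ... | no _ = s≤s z≤n

  prev<N : ∀ {s} → s < N → prev s < N
  prev<N {zero} _ = ≤-refl
  prev<N {suc s} lt = <-trans (n<1+n s) lt

  next-prev : ∀ {s} → s < N → next (prev s) ≡ s
  next-prev {zero} _ = next-last refl
  next-prev {suc s} lt = next-suc lt

  suc<N⊎last : ∀ {p} → p < N → suc p < N ⊎ suc p ≡ N
  suc<N⊎last {p} lt with suc p <? N
  ... | yes suc<N = inj₁ suc<N
  ... | no ¬suc<N = inj₂ (≤-antisym lt (≮⇒≥ ¬suc<N))

  next-injective : ∀ {p p'} → p < N → p' < N → next p ≡ next p' → p ≡ p'
  next-injective {p} {p'} lt lt' eq with suc<N⊎last lt | suc<N⊎last lt'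
  ... | inj₁ a | inj₁ b = suc-injective (trans (sym (next-suc a)) (trans eq (next-suc b)))
  ... | inj₁ a | inj₂ b with () ← trans (sym (next-suc a)) (trans eq (next-last b))
  ... | inj₂ a | inj₁ b with () ← trans (sym (next-last a)) (trans eq (next-suc b))
  ... | inj₂ a | inj₂ b = suc-injective (trans a (sym b))

  ev-last : ∀ {p} → suc p ≡ N → ev p ≡ false
  ev-last {p} eq with ev p | trans (cong ev eq) ev-N
  ... | false | _ = refl

  -- Since N is even, parity alternates all the way round the cycle.
  ev-next : ∀ {p} → p < N → ev (next p) ≡ not (ev p)
  ev-next {p} lt with suc<N⊎last lt
  ... | inj₁ a rewrite next-suc a = refl
  ... | inj₂ a rewrite next-last a | ev-last a = refl

  even⇒suc<N : ∀ {p} → ev p ≡ true → p < N → suc p < N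
  even⇒suc<N e lt with suc<N⊎last lt
  ... | inj₁ a = a
  ... | inj₂ a = ⊥-elim (not-¬ refl (trans (sym e) (ev-last a)))

  next≢ : ∀ {p} → p < N → next p ≢ p
  next≢ {p} lt eq = not-¬ refl (sym (trans (sym (ev-next lt)) (cong ev eq)))

  2≢N : 2 ≢ N
  2≢N eq with () ← trans (suc-injective (suc-injective eq)) (+-suc k (suc (k + 0)))

  next²≢ : ∀ {p} → p < N → next (next p) ≢ p
  next²≢ {p} lt eq with suc<N⊎last lt
  ... | inj₂ a rewrite next-last a | next-suc {0} (s≤s (s≤s z≤n)) = 2≢N (trans (cong suc eq) a)
  ... | inj₁ a rewrite next-suc a with suc<N⊎last a
  ...   | inj₁ b rewrite next-suc b = <-irrefl (sym eq) (<-trans (n<1+n p) (n<1+n (suc p)))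
  ...   | inj₂ b rewrite next-last b = 2≢N (trans (cong (λ x → suc (suc x)) eq) b)

  next≡0⇒last : ∀ {p} → p < N → next p ≡ 0 → suc p ≡ N
  next≡0⇒last lt eq with suc<N⊎last lt
  ... | inj₂ a = a
  ... | inj₁ a with () ← trans (sym (next-suc a)) eq

  next≡1⇒0 : ∀ {p} → p < N → next p ≡ 1 → p ≡ 0
  next≡1⇒0 lt eq with suc<N⊎last lt
  ... | inj₁ a = suc-injective (trans (sym (next-suc a)) eq)
  ... | inj₂ a with () ← trans (sym (next-last a)) eq

  backward : ℕ → ℕ → ℕ
  backward zero p = p
  backward (suc d) p = backward d (prev p)

  backward-+ : ∀ d q → backward d (d + q) ≡ q
  backward-+ zero q = refl
  backward-+ (suc d) q = backward-+ d q

  backward-+ˡ : ∀ a b x → backward (a + b) x ≡ backward b (backward a x)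
  backward-+ˡ zero b x = refl
  backward-+ˡ (suc a) b x = backward-+ˡ a b (prev x)

  backward-reaches : ∀ {p q} → q < N → ∃ λ d → backward d p ≡ q
  backward-reaches {p} {q} q<N with ≤-total q p
  ... | inj₁ q≤p = p ∸ q , subst (λ x → backward (p ∸ q) x ≡ q) (m∸n+n≡m q≤p) (backward-+ (p ∸ q) q)
  ... | inj₂ _ = p + suc r , (begin
    backward (p + suc r) p          ≡⟨ backward-+ˡ p (suc r) p ⟩
    backward (suc r) (backward p p) ≡⟨ cong (backward (suc r)) p↦0 ⟩
    backward r (pred N)             ≡⟨ cong (backward r) (m∸n+n≡m (<⇒≤pred q<N)) ⟨
    backward r (r + q)              ≡⟨ backward-+ r q ⟩
    q                               ∎)
    where
    open ≡-Reasoning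
    r = pred N ∸ q
    p↦0 : backward p p ≡ 0
    p↦0 = subst (λ x → backward p x ≡ 0) (+-identityʳ p) (backward-+ p 0)

  -- Walking backwards from a position of P to one outside P, one meets the start of an arc of P.
  arc-start : ∀ (P : List ℕ) {p q} → p < N → q < N → p ∈ P → q ∉ P →
              Σ ℕ λ s → s ∈ P × s < N × prev s ∉ P
  arc-start P {p} p<N q<N p∈P q∉P with backward-reaches {p} q<N
  ... | d , reached = walk d p p<N p∈P (subst (_∉ P) (sym reached) q∉P)
    where
    walk : ∀ d p → p < N → p ∈ P → backward d p ∉ P → Σ ℕ λ s → s ∈ P × s < N × prev s ∉ P
    walk zero p _ p∈P p∉P = ⊥-elim (p∉P p∈P)
    walk (suc d) p p<N p∈P end∉P with prev p ∈? P
    ... | yes prev∈P = walk d (prev p) (prev<N p<N) prev∈P end∉P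
    ... | no prev∉P = p , p∈P , p<N , prev∉P

module _ {A : Set} where

  infix 4 _⊆₃_ _≋_

  _⊆₃_ : Tri A → Tri A → Set
  (x , y , z) ⊆₃ t = x ∈T t × y ∈T t × z ∈T t

  _≋_ : Tri A → Tri A → Set
  s ≋ t = s ⊆₃ t × t ⊆₃ s

  Distinct₃ : Tri A → Set
  Distinct₃ (x , y , z) = x ≢ y × y ≢ z × x ≢ z

  ∈T₁ : ∀ {a b c : A} → a ∈T (a , b , c)
  ∈T₁ = inj₁ refl

  ∈T₂ : ∀ {a b c : A} → b ∈T (a , b , c)
  ∈T₂ = inj₂ (inj₁ refl)

  ∈T₃ : ∀ {a b c : A} → c ∈T (a , b , c)
  ∈T₃ = inj₂ (inj₂ refl)

  ⊆₃-∈ : ∀ {s t : Tri A} {w} → s ⊆₃ t → w ∈T s → w ∈T t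
  ⊆₃-∈ {s = _ , _ , _} (x∈ , _ , _) (inj₁ refl) = x∈
  ⊆₃-∈ {s = _ , _ , _} (_ , y∈ , _) (inj₂ (inj₁ refl)) = y∈
  ⊆₃-∈ {s = _ , _ , _} (_ , _ , z∈) (inj₂ (inj₂ refl)) = z∈

  ⊆₃-trans : ∀ {r s t : Tri A} → r ⊆₃ s → s ⊆₃ t → r ⊆₃ t
  ⊆₃-trans {r = _ , _ , _} (x∈ , y∈ , z∈) s⊆t = ⊆₃-∈ s⊆t x∈ , ⊆₃-∈ s⊆t y∈ , ⊆₃-∈ s⊆t z∈

  ∈T-dec : DecidableEquality A → ∀ w (t : Tri A) → Dec (w ∈T t)
  ∈T-dec _≟_ w (x , y , z) with w ≟ x | w ≟ y | w ≟ z
  ... | yes e | _ | _ = yes (inj₁ e)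
  ... | no _ | yes e | _ = yes (inj₂ (inj₁ e))
  ... | no _ | no _ | yes e = yes (inj₂ (inj₂ e))
  ... | no ¬x | no ¬y | no ¬z = no λ { (inj₁ e) → ¬x e ; (inj₂ (inj₁ e)) → ¬y e ; (inj₂ (inj₂ e)) → ¬z e }

  ≋-dec : DecidableEquality A → ∀ (s t : Tri A) → Dec (s ≋ t)
  ≋-dec _≟_ s t = ⊆₃-dec s t ×-dec ⊆₃-dec t s
    where
    ⊆₃-dec : ∀ s t → Dec (s ⊆₃ t)
    ⊆₃-dec (x , y , z) t = ∈T-dec _≟_ x t ×-dec (∈T-dec _≟_ y t ×-dec ∈T-dec _≟_ z t)

  ⊆T-∈ : ∀ {S} (t : Tri A) {w} → t ⊆T S → w ∈T t → w ∈ S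
  ⊆T-∈ (_ , _ , _) (x∈ , _ , _) (inj₁ refl) = x∈
  ⊆T-∈ (_ , _ , _) (_ , y∈ , _) (inj₂ (inj₁ refl)) = y∈
  ⊆T-∈ (_ , _ , _) (_ , _ , z∈) (inj₂ (inj₂ refl)) = z∈

  triangle-adjacent : ∀ {E : A → A → Set} → (∀ {x y} → E x y → E y x) → ∀ {x y z u v} →
    E x y × E y z × E x z → u ∈T (x , y , z) → v ∈T (x , y , z) → u ≢ v → E u v
  triangle-adjacent sym (xy , yz , xz) = λ
    { (inj₁ refl) (inj₁ refl) ne → ⊥-elim (ne refl)
    ; (inj₁ refl) (inj₂ (inj₁ refl)) _ → xy
    ; (inj₁ refl) (inj₂ (inj₂ refl)) _ → xz
    ; (inj₂ (inj₁ refl)) (inj₁ refl) _ → sym xy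
    ; (inj₂ (inj₁ refl)) (inj₂ (inj₁ refl)) ne → ⊥-elim (ne refl)
    ; (inj₂ (inj₁ refl)) (inj₂ (inj₂ refl)) _ → yz
    ; (inj₂ (inj₂ refl)) (inj₁ refl) _ → sym xz
    ; (inj₂ (inj₂ refl)) (inj₂ (inj₁ refl)) _ → sym yz
    ; (inj₂ (inj₂ refl)) (inj₂ (inj₂ refl)) ne → ⊥-elim (ne refl)
    }

module _ {n : ℕ} where

  labelling-≋ : ∀ {t l : Tri (Fin n)} → IsLabelling t l → t ≋ l
  labelling-≋ lab-xyz = (∈T₁ , ∈T₂ , ∈T₃) , (∈T₁ , ∈T₂ , ∈T₃)
  labelling-≋ lab-xzy = (∈T₁ , ∈T₃ , ∈T₂) , (∈T₁ , ∈T₃ , ∈T₂)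
  labelling-≋ lab-yxz = (∈T₂ , ∈T₁ , ∈T₃) , (∈T₂ , ∈T₁ , ∈T₃)
  labelling-≋ lab-yzx = (∈T₃ , ∈T₁ , ∈T₂) , (∈T₂ , ∈T₃ , ∈T₁)
  labelling-≋ lab-zxy = (∈T₂ , ∈T₃ , ∈T₁) , (∈T₃ , ∈T₁ , ∈T₂)
  labelling-≋ lab-zyx = (∈T₃ , ∈T₂ , ∈T₁) , (∈T₃ , ∈T₂ , ∈T₁)

  triple-distinct : (T : Triple n) → Distinct₃ (proj₁ T)
  triple-distinct (_ , x<y , y<z) =
    (λ e → <-irrefl (cong toℕ e) x<y) , (λ e → <-irrefl (cong toℕ e) y<z) ,
    (λ e → <-irrefl (cong toℕ e) (ℕ.<-trans x<y y<z))

  labelling-distinct : ∀ {t} {x y z : Fin n} → Distinct₃ t → IsLabelling t (x , y , z) → Distinct₃ (x , y , z)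
  labelling-distinct (xy , yz , xz) lab-xyz = xy , yz , xz
  labelling-distinct (xy , yz , xz) lab-xzy = xz , (λ e → yz (sym e)) , xy
  labelling-distinct (xy , yz , xz) lab-yxz = (λ e → xy (sym e)) , xz , yz
  labelling-distinct (xy , yz , xz) lab-yzx = yz , (λ e → xz (sym e)) , (λ e → xy (sym e))
  labelling-distinct (xy , yz , xz) lab-zxy = (λ e → xz (sym e)) , xy , (λ e → yz (sym e))
  labelling-distinct (xy , yz , xz) lab-zyx = (λ e → yz (sym e)) , (λ e → xy (sym e)) , (λ e → xz (sym e))

  Triple-≟ : DecidableEquality (Triple n)
  Triple-≟ ((x , y , z) , p , q) ((x' , y' , z') , p' , q') with x F.≟ x' | y F.≟ y' | z F.≟ z'
  ... | yes refl | yes refl | yes refl rewrite ≤-irrelevant p p' | ≤-irrelevant q q' = yes refl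
  ... | no ne | _ | _ = no λ { refl → ne refl }
  ... | yes _ | no ne | _ = no λ { refl → ne refl }
  ... | yes _ | yes _ | no ne = no λ { refl → ne refl }

  -- Compare the minima, then the maxima, then the middle vertices.
  Triple-≋⇒≡ : ∀ (T T' : Triple n) → proj₁ T ≋ proj₁ T' → T ≡ T'
  Triple-≋⇒≡ T@((x , y , z) , x<y , y<z) T'@((x' , y' , z') , x<y' , y<z') (T⊆T' , T'⊆T) = equal
    where
    min≤ : ∀ (U : Triple n) {w} → w ∈T proj₁ U → toℕ (proj₁ (proj₁ U)) ≤ toℕ w
    min≤ _ (inj₁ refl) = ≤-refl
    min≤ (_ , a<b , _) (inj₂ (inj₁ refl)) = <⇒≤ a<b
    min≤ (_ , a<b , b<c) (inj₂ (inj₂ refl)) = <⇒≤ (ℕ.<-trans a<b b<c)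
    ≤max : ∀ (U : Triple n) {w} → w ∈T proj₁ U → toℕ w ≤ toℕ (proj₂ (proj₂ (proj₁ U)))
    ≤max (_ , a<b , b<c) (inj₁ refl) = <⇒≤ (ℕ.<-trans a<b b<c)
    ≤max (_ , _ , b<c) (inj₂ (inj₁ refl)) = <⇒≤ b<c
    ≤max _ (inj₂ (inj₂ refl)) = ≤-refl
    x≡x' : x ≡ x'
    x≡x' = toℕ-injective (≤-antisym (min≤ T (proj₁ T'⊆T)) (min≤ T' (proj₁ T⊆T')))
    z≡z' : z ≡ z'
    z≡z' = toℕ-injective (≤-antisym (≤max T' (proj₂ (proj₂ T⊆T'))) (≤max T (proj₂ (proj₂ T'⊆T))))
    middle : y ∈T (x' , y' , z') → y ≡ y'
    middle (inj₁ e) = ⊥-elim (<-irrefl (cong toℕ (trans x≡x' (sym e))) x<y)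
    middle (inj₂ (inj₁ e)) = e
    middle (inj₂ (inj₂ e)) = ⊥-elim (<-irrefl (cong toℕ (trans e (sym z≡z'))) y<z)
    equal : T ≡ T'
    equal with x≡x' | middle (proj₁ (proj₂ T⊆T')) | z≡z'
    ... | refl | refl | refl rewrite ≤-irrelevant x<y x<y' | ≤-irrelevant y<z y<z' = refl

  sort : (t : Tri (Fin n)) → Distinct₃ t → Σ (Triple n) λ T → t ≋ proj₁ T
  sort (x , y , z) (xy , yz , xz) with <-cmp x y | <-cmp y z | <-cmp x z
  ... | tri≈ _ e _ | _ | _ = ⊥-elim (xy e)
  ... | _ | tri≈ _ e _ | _ = ⊥-elim (yz e)
  ... | _ | _ | tri≈ _ e _ = ⊥-elim (xz e)
  ... | tri< a _ _ | tri< b _ _ | _ = ((x , y , z) , a , b) , (∈T₁ , ∈T₂ , ∈T₃) , (∈T₁ , ∈T₂ , ∈T₃)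
  ... | tri< a _ _ | tri> _ _ b | tri< c _ _ = ((x , z , y) , c , b) , (∈T₁ , ∈T₃ , ∈T₂) , (∈T₁ , ∈T₃ , ∈T₂)
  ... | tri< a _ _ | tri> _ _ b | tri> _ _ c = ((z , x , y) , c , a) , (∈T₂ , ∈T₃ , ∈T₁) , (∈T₃ , ∈T₁ , ∈T₂)
  ... | tri> _ _ a | tri< b _ _ | tri< c _ _ = ((y , x , z) , a , c) , (∈T₂ , ∈T₁ , ∈T₃) , (∈T₂ , ∈T₁ , ∈T₃)
  ... | tri> _ _ a | tri< b _ _ | tri> _ _ c = ((y , z , x) , b , c) , (∈T₃ , ∈T₁ , ∈T₂) , (∈T₂ , ∈T₃ , ∈T₁)
  ... | tri> _ _ a | tri> _ _ b | _ = ((z , y , x) , b , a) , (∈T₃ , ∈T₂ , ∈T₁) , (∈T₃ , ∈T₂ , ∈T₁)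

  private
    Raw : Set
    Raw = Fin n × Fin n × Fin n

    sorted? : (r : Raw) → Dec (proj₁ r F.< proj₁ (proj₂ r) × proj₁ (proj₂ r) F.< proj₂ (proj₂ r))
    sorted? (x , y , z) = (x F.<? y) ×-dec (y F.<? z)

    sorted : List Raw → List (Triple n)
    sorted [] = []
    sorted (r ∷ rs) with sorted? r
    ... | yes s = (r , s) ∷ sorted rs
    ... | no _ = sorted rs

    ∈-sorted⁻ : ∀ rs {T} → T ∈ sorted rs → proj₁ T ∈ rs
    ∈-sorted⁻ (r ∷ rs) T∈ with sorted? r
    ∈-sorted⁻ (r ∷ rs) (here refl) | yes _ = here refl
    ∈-sorted⁻ (r ∷ rs) (there T∈) | yes _ = there (∈-sorted⁻ rs T∈)
    ... | no _ = there (∈-sorted⁻ rs T∈)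

    ∈-sorted⁺ : ∀ rs (T : Triple n) → proj₁ T ∈ rs → T ∈ sorted rs
    ∈-sorted⁺ (r ∷ rs) T r∈ with sorted? r
    ∈-sorted⁺ (r ∷ rs) (_ , s') (here refl) | yes s
      rewrite ×-≡,≡→≡ {p₁ = s} {s'} (≤-irrelevant _ _ , ≤-irrelevant _ _) = here refl
    ∈-sorted⁺ (r ∷ rs) T (there r∈) | yes _ = there (∈-sorted⁺ rs T r∈)
    ∈-sorted⁺ (r ∷ rs) T (here refl) | no unsorted = ⊥-elim (unsorted (proj₂ T))
    ∈-sorted⁺ (r ∷ rs) T (there r∈) | no _ = ∈-sorted⁺ rs T r∈

    sorted-unique : ∀ rs → Unique rs → Unique (sorted rs)
    sorted-unique [] _ = []
    sorted-unique (r ∷ rs) (r∉rs ∷ u) with sorted? r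
    ... | yes _ = All.tabulate (λ T∈ e → All.lookup r∉rs (∈-sorted⁻ rs T∈) (cong proj₁ e)) ∷ sorted-unique rs u
    ... | no _ = sorted-unique rs u

    raw : List Raw
    raw = cartesianProduct (allFin n) (cartesianProduct (allFin n) (allFin n))

  allTriples : List (Triple n)
  allTriples = sorted raw

  ∈-allTriples : ∀ T → T ∈ allTriples
  ∈-allTriples T@((x , y , z) , _) =
    ∈-sorted⁺ raw T (∈-cartesianProduct⁺ (∈-allFin x) (∈-cartesianProduct⁺ (∈-allFin y) (∈-allFin z)))

  allTriples-unique : Unique allTriples
  allTriples-unique = sorted-unique raw (cartesianProduct⁺ (allFin⁺ n) (cartesianProduct⁺ (allFin⁺ n) (allFin⁺ n)))

module SphereDecompositions (n h : ℕ) (lab : Triple n → Fin n × Fin n × Fin n)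
  (lab-ok : ∀ T → IsLabelling (proj₁ T) (lab T)) where

  g : ℕ
  g = suc (suc (suc h))

  open Sphere n g lab public
  open EvenCycle (suc h) public
  open import Data.List.Membership.DecPropositional ℕ._≟_ using (_∈?_)

  -- The vertices of the g-sphere of T: the apices a and c, and  rim q  standing for b_{q+1}.
  data Place : Set where
    apex-a apex-c : Place
    rim : ℕ → Place

  rim-injective : ∀ {q q'} → rim q ≡ rim q' → q ≡ q'
  rim-injective refl = refl

  InRange : Place → Set
  InRange apex-a = ⊤
  InRange apex-c = ⊤
  InRange (rim q) = q < N

  data IsOld : Place → Set where
    old-a : IsOld apex-a
    old-b₁ : IsOld (rim 0)
    old-b₂ : IsOld (rim 1)

  M : ℕ
  M = 2 * g ∸ 2

  rim-new : Triple n → (k : ℕ) → Dec (k < M) → V n g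
  rim-new T k (yes k<M) = bnew T (fromℕ< k<M)
  rim-new T k (no _) = old (b₁Of T)

  -- b_{q+1}; positions q ≥ N are junk and are sent to b₁.
  rimV : Triple n → ℕ → V n g
  rimV T zero = old (b₁Of T)
  rimV T (suc zero) = old (b₂Of T)
  rimV T (suc (suc k)) = rim-new T k (k <? M)

  rimV-new : ∀ T {k} (k<M : k < M) → rimV T (suc (suc k)) ≡ bnew T (fromℕ< k<M)
  rimV-new T {k} k<M with k <? M
  ... | yes k<M' = cong (λ lt → bnew T (fromℕ< lt)) (≤-irrelevant k<M' k<M)
  ... | no k≮M = ⊥-elim (k≮M k<M)

  vertex : Triple n → Place → V n g
  vertex T apex-a = aV T
  vertex T apex-c = cV T
  vertex T (rim q) = rimV T q

  labelled-distinct : ∀ T → Distinct₃ (lab T)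
  labelled-distinct T = labelling-distinct (triple-distinct T) (lab-ok T)

  rim-position : Triple n → V n g → ℕ
  rim-position T (old x) = if does (x F.≟ b₁Of T) then 0 else 1
  rim-position T (bnew _ k) = suc (suc (toℕ k))
  rim-position T (cnew _) = 0

  rim-position-rimV : ∀ T {q} → q < N → rim-position T (rimV T q) ≡ q
  rim-position-rimV T {zero} _ with b₁Of T F.≟ b₁Of T
  ... | yes _ = refl
  ... | no ne = ⊥-elim (ne refl)
  rim-position-rimV T {suc zero} _ with b₂Of T F.≟ b₁Of T
  ... | yes e = ⊥-elim (proj₁ (proj₂ (labelled-distinct T)) (sym e))
  ... | no _ = refl
  rim-position-rimV T {suc (suc k)} (s≤s (s≤s k<M)) rewrite rimV-new T k<M =
    cong (λ i → suc (suc i)) (toℕ-fromℕ< k<M)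

  rimV-injective : ∀ T {q q'} → q < N → q' < N → rimV T q ≡ rimV T q' → q ≡ q'
  rimV-injective T {q} {q'} q<N q'<N eq =
    trans (sym (rim-position-rimV T q<N)) (trans (cong (rim-position T) eq) (rim-position-rimV T q'<N))

  old-injective : ∀ {x y : Fin n} → old {g = g} x ≡ old y → x ≡ y
  old-injective refl = refl

  a≢rimV : ∀ T {q} → q < N → aV T ≢ rimV T q
  a≢rimV T {zero} _ eq = proj₁ (labelled-distinct T) (old-injective eq)
  a≢rimV T {suc zero} _ eq = proj₂ (proj₂ (labelled-distinct T)) (old-injective eq)
  a≢rimV T {suc (suc k)} (s≤s (s≤s k<M)) eq with () ← trans eq (rimV-new T k<M)

  c≢rimV : ∀ T {q} → q < N → cV T ≢ rimV T q
  c≢rimV T {suc (suc k)} (s≤s (s≤s k<M)) eq with () ← trans eq (rimV-new T k<M)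

  vertex-injective : ∀ T {l l'} → InRange l → InRange l' → vertex T l ≡ vertex T l' → l ≡ l'
  vertex-injective T {apex-a} {apex-a} _ _ _ = refl
  vertex-injective T {apex-c} {apex-c} _ _ _ = refl
  vertex-injective T {apex-a} {rim q} _ q<N eq = ⊥-elim (a≢rimV T q<N eq)
  vertex-injective T {apex-c} {rim q} _ q<N eq = ⊥-elim (c≢rimV T q<N eq)
  vertex-injective T {rim q} {apex-a} q<N _ eq = ⊥-elim (a≢rimV T q<N (sym eq))
  vertex-injective T {rim q} {apex-c} q<N _ eq = ⊥-elim (c≢rimV T q<N (sym eq))
  vertex-injective T {rim q} {rim q'} q<N q'<N eq = cong rim (rimV-injective T q<N q'<N eq)

  IsB-rimV : ∀ T {q} → q < N → IsB T (suc q) (rimV T q)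
  IsB-rimV T {zero} _ = isB₁
  IsB-rimV T {suc zero} _ = isB₂
  IsB-rimV T {suc (suc k)} (s≤s (s≤s k<M)) =
    subst₂ (IsB T) (cong (λ i → suc (suc (suc i))) (toℕ-fromℕ< k<M)) (sym (rimV-new T k<M)) (isBₖ (fromℕ< k<M))

  IsB⇒rimV : ∀ {T j v} → IsB T j v → Σ ℕ λ q → j ≡ suc q × q < N × v ≡ rimV T q
  IsB⇒rimV isB₁ = 0 , refl , s≤s z≤n , refl
  IsB⇒rimV isB₂ = 1 , refl , s≤s (s≤s z≤n) , refl
  IsB⇒rimV {T} (isBₖ k) = suc (suc (toℕ k)) , refl , s≤s (s≤s (toℕ<n k)) ,
    sym (trans (rimV-new T (toℕ<n k)) (cong (bnew T) (fromℕ<-toℕ k (toℕ<n k))))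

  owner : V n g → Maybe (Triple n)
  owner (old _) = nothing
  owner (bnew T _) = just T
  owner (cnew T) = just T

  V-≟ : DecidableEquality (V n g)
  V-≟ (old x) (old y) with x F.≟ y
  ... | yes refl = yes refl
  ... | no x≢y = no λ { refl → x≢y refl }
  V-≟ (bnew T k) (bnew T' k') with Triple-≟ T T' | k F.≟ k'
  ... | yes refl | yes refl = yes refl
  ... | no T≢T' | _ = no λ { refl → T≢T' refl }
  ... | yes _ | no k≢k' = no λ { refl → k≢k' refl }
  V-≟ (cnew T) (cnew T') with Triple-≟ T T'
  ... | yes refl = yes refl
  ... | no T≢T' = no λ { refl → T≢T' refl }
  V-≟ (old _) (bnew _ _) = no λ ()
  V-≟ (old _) (cnew _) = no λ ()
  V-≟ (bnew _ _) (old _) = no λ ()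
  V-≟ (bnew _ _) (cnew _) = no λ ()
  V-≟ (cnew _) (old _) = no λ ()
  V-≟ (cnew _) (bnew _ _) = no λ ()

  owner-vertex : ∀ T {l} → InRange l → owner (vertex T l) ≡ just T ⊎ (owner (vertex T l) ≡ nothing × IsOld l)
  owner-vertex T {apex-a} _ = inj₂ (refl , old-a)
  owner-vertex T {apex-c} _ = inj₁ refl
  owner-vertex T {rim zero} _ = inj₂ (refl , old-b₁)
  owner-vertex T {rim (suc zero)} _ = inj₂ (refl , old-b₂)
  owner-vertex T {rim (suc (suc k))} (s≤s (s≤s k<M)) rewrite rimV-new T k<M = inj₁ refl

  old-vertex : ∀ T {l} → IsOld l → Σ (Fin n) λ x → vertex T l ≡ old x × x ∈T proj₁ T
  old-vertex T old-a = aOf T , refl , ⊆₃-∈ (proj₂ (labelling-≋ (lab-ok T))) ∈T₁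
  old-vertex T old-b₁ = b₁Of T , refl , ⊆₃-∈ (proj₂ (labelling-≋ (lab-ok T))) ∈T₂
  old-vertex T old-b₂ = b₂Of T , refl , ⊆₃-∈ (proj₂ (labelling-≋ (lab-ok T))) ∈T₃

  old-place : ∀ T {x} → x ∈T proj₁ T → Σ Place λ l → IsOld l × old x ≡ vertex T l
  old-place T x∈T with ⊆₃-∈ (proj₁ (labelling-≋ (lab-ok T))) x∈T
  ... | inj₁ refl = apex-a , old-a , refl
  ... | inj₂ (inj₁ refl) = rim 0 , old-b₁ , refl
  ... | inj₂ (inj₂ refl) = rim 1 , old-b₂ , refl

  old-vertices : Triple n → List (V n g)
  old-vertices T = aV T ∷ rimV T 0 ∷ rimV T 1 ∷ []

  old-vertex-∈ : ∀ T {l} → IsOld l → vertex T l ∈ old-vertices T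
  old-vertex-∈ T old-a = here refl
  old-vertex-∈ T old-b₁ = there (here refl)
  old-vertex-∈ T old-b₂ = there (there (here refl))

  -- Orientation  true  is the in-decomposition, whose apices are c, a, c, … from position 0;
  -- orientation  false  is the out-decomposition, with apices a, c, a, … and no triangle at position 0.
  -- Position p carries the triangle with rim vertices b_{p+1} b_{p+2}.
  c-apex? : Bool → ℕ → Bool
  c-apex? true p = ev p
  c-apex? false p = not (ev p)

  apex : Bool → ℕ → Place
  apex o p = if c-apex? o p then apex-c else apex-a

  ValidPos : Bool → ℕ → Set
  ValidPos o p = p < N × (o ≡ false → 0 < p)

  triangle : Bool → Triple n → ℕ → Tri (V n g)
  triangle o T p = vertex T (apex o p) , rimV T p , rimV T (next p)

  On : Bool → ℕ → Place → Set
  On o p l = l ≡ apex o p ⊎ l ≡ rim p ⊎ l ≡ rim (next p)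

  Consecutive : ℕ → ℕ → Set
  Consecutive p q = q ≡ p ⊎ q ≡ next p

  apex-cases : ∀ o p → apex o p ≡ apex-a ⊎ apex o p ≡ apex-c
  apex-cases o p with c-apex? o p
  ... | true = inj₂ refl
  ... | false = inj₁ refl

  c-apex⇒apex-c : ∀ o {p} → c-apex? o p ≡ true → apex o p ≡ apex-c
  c-apex⇒apex-c o {p} e rewrite e = refl

  ¬c-apex⇒apex-a : ∀ o {p} → c-apex? o p ≡ false → apex o p ≡ apex-a
  ¬c-apex⇒apex-a o {p} e rewrite e = refl

  apex≢rim : ∀ o p {q} → apex o p ≢ rim q
  apex≢rim o p eq with apex-cases o p
  ... | inj₁ e with () ← trans (sym e) eq
  ... | inj₂ e with () ← trans (sym e) eq

  apex-InRange : ∀ o p → InRange (apex o p)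
  apex-InRange o p with c-apex? o p
  ... | true = tt
  ... | false = tt

  apex-parity : ∀ o {p p'} → apex o p ≡ apex o p' → ev p ≡ ev p'
  apex-parity o {p} {p'} eq = parity-of o (if-injective (c-apex? o p) (c-apex? o p') eq)
    where
    if-injective : ∀ x y → (if x then apex-c else apex-a) ≡ (if y then apex-c else apex-a) → x ≡ y
    if-injective true true _ = refl
    if-injective false false _ = refl
    parity-of : ∀ o → c-apex? o p ≡ c-apex? o p' → ev p ≡ ev p'
    parity-of true e = e
    parity-of false e with ev p | ev p'
    ... | true | true = refl
    ... | false | false = refl

  On-rim : ∀ o p {q} → On o p (rim q) → Consecutive p q
  On-rim o p (inj₁ e) = ⊥-elim (apex≢rim o p (sym e))
  On-rim o p (inj₂ (inj₁ refl)) = inj₁ refl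
  On-rim o p (inj₂ (inj₂ refl)) = inj₂ refl

  On-apex : ∀ o p {l} → (∀ {q} → l ≢ rim q) → On o p l → l ≡ apex o p
  On-apex o p _ (inj₁ e) = e
  On-apex o p not-rim (inj₂ (inj₁ e)) = ⊥-elim (not-rim e)
  On-apex o p not-rim (inj₂ (inj₂ e)) = ⊥-elim (not-rim e)

  On-InRange : ∀ o {p l} → p < N → On o p l → InRange l
  On-InRange o {p} _ (inj₁ refl) = apex-InRange o p
  On-InRange o p<N (inj₂ (inj₁ refl)) = p<N
  On-InRange o {p} _ (inj₂ (inj₂ refl)) = next<N p

  ∈-triangle⇒On : ∀ o T p {w} → w ∈T triangle o T p → Σ Place λ l → On o p l × w ≡ vertex T l
  ∈-triangle⇒On o T p (inj₁ e) = apex o p , inj₁ refl , e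
  ∈-triangle⇒On o T p (inj₂ (inj₁ e)) = rim p , inj₂ (inj₁ refl) , e
  ∈-triangle⇒On o T p (inj₂ (inj₂ e)) = rim (next p) , inj₂ (inj₂ refl) , e

  On⇒∈-triangle : ∀ {o T p l} → On o p l → vertex T l ∈T triangle o T p
  On⇒∈-triangle (inj₁ refl) = ∈T₁
  On⇒∈-triangle (inj₂ (inj₁ refl)) = ∈T₂
  On⇒∈-triangle (inj₂ (inj₂ refl)) = ∈T₃

  rims-determine : ∀ {p p' q q'} → p < N → p' < N → q ≢ q' →
    Consecutive p q → Consecutive p q' → Consecutive p' q → Consecutive p' q' → p ≡ p'
  rims-determine _ _ q≢q' (inj₁ a) (inj₁ b) _ _ = ⊥-elim (q≢q' (trans a (sym b)))
  rims-determine _ _ q≢q' (inj₂ a) (inj₂ b) _ _ = ⊥-elim (q≢q' (trans a (sym b)))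
  rims-determine _ _ q≢q' _ _ (inj₁ a) (inj₁ b) = ⊥-elim (q≢q' (trans a (sym b)))
  rims-determine _ _ q≢q' _ _ (inj₂ a) (inj₂ b) = ⊥-elim (q≢q' (trans a (sym b)))
  rims-determine _ _ _ (inj₁ a) (inj₂ _) (inj₁ c) (inj₂ _) = trans (sym a) c
  rims-determine _ _ _ (inj₂ _) (inj₁ b) (inj₂ _) (inj₁ d) = trans (sym b) d
  rims-determine _ p'<N _ (inj₁ a) (inj₂ b) (inj₂ c) (inj₁ d) =
    ⊥-elim (next²≢ p'<N (trans (cong next (trans (sym c) a)) (trans (sym b) d)))
  rims-determine _ p'<N _ (inj₂ a) (inj₁ b) (inj₁ c) (inj₂ d) =
    ⊥-elim (next²≢ p'<N (trans (cong next (trans (sym d) b)) (trans (sym a) c)))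

  apex-rim-determines : ∀ {p p' q} → p < N → p' < N → ev p ≡ ev p' →
    Consecutive p q → Consecutive p' q → p ≡ p'
  apex-rim-determines _ _ _ (inj₁ refl) (inj₁ refl) = refl
  apex-rim-determines {p} _ p'<N same (inj₁ refl) (inj₂ e) =
    ⊥-elim (not-¬ refl (trans (cong ev e) (trans (ev-next p'<N) (cong not (sym same)))))
  apex-rim-determines {p} p<N _ same (inj₂ e) (inj₁ refl) =
    ⊥-elim (not-¬ refl (trans same (trans (cong ev e) (ev-next p<N))))
  apex-rim-determines p<N p'<N _ (inj₂ e) (inj₂ e') = next-injective p<N p'<N (trans (sym e) e')

  apex-and-rim : ∀ o {p p' l q} → p < N → p' < N → (∀ {q} → l ≢ rim q) →
    On o p l → On o p' l → On o p (rim q) → On o p' (rim q) → p ≡ p'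
  apex-and-rim o {p} {p'} p<N p'<N not-rim on on' on-rim on-rim' =
    apex-rim-determines p<N p'<N (apex-parity o (trans (sym (On-apex o p not-rim on)) (On-apex o p' not-rim on')))
      (On-rim o p on-rim) (On-rim o p' on-rim')

  -- The rim vertices of a triangle are consecutive, and its apex has the parity of its position.
  On-determines : ∀ o {p p' l l'} → p < N → p' < N → l ≢ l' →
    On o p l → On o p l' → On o p' l → On o p' l' → p ≡ p'
  On-determines o {p} {p'} {l = rim q} {rim q'} p<N p'<N l≢l' on₁ on₂ on₁' on₂' =
    rims-determine p<N p'<N (λ e → l≢l' (cong rim e))
      (On-rim o p on₁) (On-rim o p on₂) (On-rim o p' on₁') (On-rim o p' on₂')
  On-determines o {p} {p'} {l = rim q} {apex-a} p<N p'<N _ on₁ on₂ on₁' on₂' = apex-and-rim o p<N p'<N (λ ()) on₂ on₂' on₁ on₁'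
  On-determines o {p} {p'} {l = rim q} {apex-c} p<N p'<N _ on₁ on₂ on₁' on₂' = apex-and-rim o p<N p'<N (λ ()) on₂ on₂' on₁ on₁'
  On-determines o {p} {p'} {l = apex-a} {rim q} p<N p'<N _ on₁ on₂ on₁' on₂' = apex-and-rim o p<N p'<N (λ ()) on₁ on₁' on₂ on₂'
  On-determines o {p} {p'} {l = apex-c} {rim q} p<N p'<N _ on₁ on₂ on₁' on₂' = apex-and-rim o p<N p'<N (λ ()) on₁ on₁' on₂ on₂'
  On-determines o {p} {p'} {l = apex-a} {apex-a} _ _ l≢l' _ _ _ _ = ⊥-elim (l≢l' refl)
  On-determines o {p} {p'} {l = apex-c} {apex-c} _ _ l≢l' _ _ _ _ = ⊥-elim (l≢l' refl)
  On-determines o {p} {p'} {l = apex-a} {apex-c} _ _ l≢l' on₁ on₂ _ _ =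
    ⊥-elim (l≢l' (trans (On-apex o p (λ ()) on₁) (sym (On-apex o p (λ ()) on₂))))
  On-determines o {p} {p'} {l = apex-c} {apex-a} _ _ l≢l' on₁ on₂ _ _ =
    ⊥-elim (l≢l' (trans (On-apex o p (λ ()) on₁) (sym (On-apex o p (λ ()) on₂))))

  -- The out-decomposition has no triangle on b₁ b₂ (position 0) and its triangles on b_{2g} b₁
  -- and on b₂ b₃ have apex c, so none of them contains two vertices of Z.
  out-old-places-equal : ∀ {p l l'} → 0 < p → p < N → IsOld l → IsOld l' → On false p l → On false p l' → l ≡ l'
  out-old-places-equal _ _ old-a old-a _ _ = refl
  out-old-places-equal _ _ old-b₁ old-b₁ _ _ = refl
  out-old-places-equal _ _ old-b₂ old-b₂ _ _ = refl
  out-old-places-equal {p} 0<p p<N old-a old-b₁ on on' with On-rim false p on'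
  ... | inj₁ refl = ⊥-elim (<-irrefl refl 0<p)
  ... | inj₂ 0≡next with () ← trans (On-apex false p (λ ()) on)
                                 (c-apex⇒apex-c false {p} (cong not (ev-last (next≡0⇒last p<N (sym 0≡next)))))
  out-old-places-equal {p} 0<p p<N old-a old-b₂ on on' with On-rim false p on'
  ... | inj₁ refl with () ← On-apex false 1 (λ ()) on
  ... | inj₂ 1≡next with refl ← next≡1⇒0 p<N (sym 1≡next) = ⊥-elim (<-irrefl refl 0<p)
  out-old-places-equal {p} 0<p p<N old-b₁ old-b₂ on on' with On-rim false p on | On-rim false p on'
  ... | inj₁ refl | _ = ⊥-elim (<-irrefl refl 0<p)
  ... | inj₂ 0≡next | inj₁ refl = ⊥-elim (2≢N (next≡0⇒last p<N (sym 0≡next)))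
  ... | inj₂ _ | inj₂ 1≡next with refl ← next≡1⇒0 p<N (sym 1≡next) = ⊥-elim (<-irrefl refl 0<p)
  out-old-places-equal 0<p p<N old-b₁ old-a on on' = sym (out-old-places-equal 0<p p<N old-a old-b₁ on' on)
  out-old-places-equal 0<p p<N old-b₂ old-a on on' = sym (out-old-places-equal 0<p p<N old-a old-b₂ on' on)
  out-old-places-equal 0<p p<N old-b₂ old-b₁ on on' = sym (out-old-places-equal 0<p p<N old-b₁ old-b₂ on' on)

  old-pair⇒in : ∀ {o p l l'} → ValidPos o p → l ≢ l' → IsOld l → IsOld l' → On o p l → On o p l' → o ≡ true
  old-pair⇒in {true} _ _ _ _ _ _ = refl
  old-pair⇒in {false} (p<N , pos) l≢l' ol ol' on on' = ⊥-elim (l≢l' (out-old-places-equal (pos refl) p<N ol ol' on on'))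

  triangle-new-vertex : ∀ o T {p} → ValidPos o p → Σ (V n g) λ w → w ∈T triangle o T p × owner w ≡ just T
  triangle-new-vertex o T {p} valid with apex-cases o p
  ... | inj₂ c = cV T , subst (λ l → cV T ∈T (vertex T l , _)) (sym c) ∈T₁ , refl
  triangle-new-vertex o T {suc (suc k)} (p<N , _) | inj₁ _ =
    rimV T (suc (suc k)) , ∈T₂ , new-rim (s≤s (s≤s z≤n)) p<N
    where
    new-rim : ∀ {q} → 2 ≤ q → q < N → owner (rimV T q) ≡ just T
    new-rim {suc (suc k)} _ (s≤s (s≤s k<M)) rewrite rimV-new T k<M = refl
    new-rim {suc zero} (s≤s ()) _
  triangle-new-vertex o T {suc zero} _ | inj₁ _ rewrite next-suc {1} (s≤s (s≤s (s≤s z≤n))) | rimV-new T {0} (s≤s z≤n) =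
    bnew T (fromℕ< (s≤s z≤n)) , ∈T₃ , refl
  triangle-new-vertex false T {zero} (_ , pos) | inj₁ _ = ⊥-elim (<-irrefl refl (pos refl))
  triangle-new-vertex true T {zero} _ | inj₁ ()

  triangle-distinct : ∀ o T {p} → p < N → Distinct₃ (triangle o T p)
  triangle-distinct o T {p} p<N =
    (λ e → apex≢rim o p (vertex-injective T {apex o p} {rim p} (apex-InRange o p) p<N e)) ,
    (λ e → next≢ p<N (sym (rim-injective (vertex-injective T {rim p} {rim (next p)} p<N (next<N p) e)))) ,
    (λ e → apex≢rim o p (vertex-injective T {apex o p} {rim (next p)} (apex-InRange o p) (next<N p) e))

  IsB-rimV≡ : ∀ T {q j} → q < N → j ≡ suc q → IsB T j (rimV T q)
  IsB-rimV≡ T q<N refl = IsB-rimV T q<N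

  private
    2*≡+ : ∀ k → 2 * k ≡ k + k
    2*≡+ k = cong (k +_) (+-identityʳ k)

    odd-index : ∀ k → 2 * suc k ≡ suc (suc (k + k))
    odd-index k = trans (2*≡+ (suc k)) (cong suc (+-suc k k))

  triangle-InB : ∀ o T {p} → ValidPos o p → InB T (triangle o T p)
  triangle-InB true T {p} (p<N , _) with parity p
  ... | k , inj₁ (refl , e) rewrite e | next-suc (even⇒suc<N e p<N) =
    in-c {k = k} (IsB-rimV≡ T p<N (cong suc (2*≡+ k))) (IsB-rimV≡ T (even⇒suc<N e p<N) (cong (λ x → suc (suc x)) (2*≡+ k)))
  ... | k , inj₂ (refl , e) rewrite e with suc<N⊎last p<N
  ...   | inj₁ s<N rewrite next-suc s<N =
    in-a {k = suc k} (s≤s z≤n) (IsB-rimV≡ T p<N (odd-index k)) (IsB-rimV≡ T s<N (cong suc (odd-index k)))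
  ...   | inj₂ last rewrite next-last last = in-wrap (IsB-rimV≡ T p<N (sym last)) isB₁
  triangle-InB false T {p} (p<N , pos) with parity p
  ... | k , inj₂ (refl , e) rewrite e with suc<N⊎last p<N
  ...   | inj₁ s<N rewrite next-suc s<N =
    out-c {k = suc k} (s≤s z≤n) (IsB-rimV≡ T p<N (odd-index k)) (IsB-rimV≡ T s<N (cong suc (odd-index k)))
  ...   | inj₂ last rewrite next-last last = out-wrap (IsB-rimV≡ T p<N (sym last)) isB₁
  triangle-InB false T {p} (p<N , pos) | zero , inj₁ (refl , _) = ⊥-elim (<-irrefl refl (pos refl))
  triangle-InB false T {p} (p<N , pos) | suc k , inj₁ (refl , e) rewrite e | next-suc (even⇒suc<N e p<N) =
    out-a {k = suc k} (s≤s z≤n) (IsB-rimV≡ T p<N (cong suc (2*≡+ (suc k))))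
      (IsB-rimV≡ T (even⇒suc<N e p<N) (cong (λ x → suc (suc x)) (2*≡+ (suc k))))

  c-apex?-suc : ∀ o p → c-apex? o (suc p) ≡ not (c-apex? o p)
  c-apex?-suc true p = refl
  c-apex?-suc false p = refl

  c-apex?-next : ∀ o {p} → p < N → c-apex? o (next p) ≡ not (c-apex? o p)
  c-apex?-next true p<N = ev-next p<N
  c-apex?-next false p<N = cong not (ev-next p<N)

  c-apex⇒0< : ∀ {q} → c-apex? false q ≡ true → 0 < q
  c-apex⇒0< {suc q} _ = s≤s z≤n

  Covers : Bool → ℕ → Place → Place → Set
  Covers o p l l' = ValidPos o p × On o p l × On o p l'

  Covers-sym : ∀ {o p l l'} → Covers o p l l' → Covers o p l' l
  Covers-sym (valid , on , on') = valid , on' , on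

  a-rim-covered : ∀ o {q} → 2 ≤ q → q < N → Σ ℕ λ p → Covers o p apex-a (rim q)
  a-rim-covered o {q} 2≤q q<N with c-apex? o q in e
  ... | false = q , (q<N , λ _ → ≤-trans (s≤s z≤n) 2≤q) , inj₁ (sym (¬c-apex⇒apex-a o e)) , inj₂ (inj₁ refl)
  a-rim-covered o {suc p} (s≤s 1≤p) q<N | true =
    p , (<-trans (n<1+n p) q<N , λ _ → 1≤p) ,
    inj₁ (sym (¬c-apex⇒apex-a o (not-injective (trans (sym (c-apex?-suc o p)) e)))) ,
    inj₂ (inj₂ (cong rim (sym (next-suc q<N))))

  c-rim-covered : ∀ o {q} → q < N → Σ ℕ λ p → Covers o p apex-c (rim q)
  c-rim-covered o {q} q<N with c-apex? o q in e
  ... | true = q , (q<N , λ { refl → c-apex⇒0< e }) , inj₁ (sym (c-apex⇒apex-c o e)) , inj₂ (inj₁ refl)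
  ... | false = prev q , (prev<N q<N , λ { refl → c-apex⇒0< c-at-prev }) ,
                inj₁ (sym (c-apex⇒apex-c o c-at-prev)) , inj₂ (inj₂ (cong rim (sym (next-prev q<N))))
    where
    c-at-prev : c-apex? o (prev q) ≡ true
    c-at-prev = not-injective (trans (sym c-at-q) e)
      where
      c-at-q : c-apex? o q ≡ not (c-apex? o (prev q))
      c-at-q = subst (λ x → c-apex? o x ≡ not (c-apex? o (prev q))) (next-prev q<N) (c-apex?-next o (prev<N q<N))

  old-pair-covered : ∀ {l l'} → IsOld l → IsOld l' → l ≢ l' → Σ ℕ λ p → Covers true p l l'
  old-pair-covered old-a old-a ne = ⊥-elim (ne refl)
  old-pair-covered old-b₁ old-b₁ ne = ⊥-elim (ne refl)
  old-pair-covered old-b₂ old-b₂ ne = ⊥-elim (ne refl)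
  old-pair-covered old-a old-b₁ _ =
    pred N , (≤-refl , λ ()) , inj₁ (sym (¬c-apex⇒apex-a true {pred N} (ev-last {pred N} refl))) ,
    inj₂ (inj₂ (cong rim (sym (next-last refl))))
  old-pair-covered old-a old-b₂ _ = 1 , (s≤s (s≤s z≤n) , λ ()) , inj₁ refl , inj₂ (inj₁ refl)
  old-pair-covered old-b₁ old-b₂ _ =
    0 , (s≤s z≤n , λ ()) , inj₂ (inj₁ refl) , inj₂ (inj₂ (cong rim (sym (next-suc (s≤s (s≤s z≤n))))))
  old-pair-covered old-b₁ old-a ne = map₂ Covers-sym (old-pair-covered old-a old-b₁ (λ e → ne (sym e)))
  old-pair-covered old-b₂ old-a ne = map₂ Covers-sym (old-pair-covered old-a old-b₂ (λ e → ne (sym e)))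
  old-pair-covered old-b₂ old-b₁ ne = map₂ Covers-sym (old-pair-covered old-b₁ old-b₂ (λ e → ne (sym e)))

  SphereVerticesIn : Triple n → List (V n g) → List (V n g) → Set
  SphereVerticesIn T S X = Unique X × X ⊆ S × (∀ {w} → w ∈ X → Σ Place λ l → InRange l × w ≡ vertex T l)

  module SphereBlock (o : Bool) (T : Triple n) (S : List (V n g)) (P : List ℕ)
    (P-unique : Unique P) (P-valid : ∀ {p} → p ∈ P → ValidPos o p)
    (P-in-S : ∀ {p} → p ∈ P → ∀ {w} → w ∈T triangle o T p → w ∈ S) where

    Spanned : Place → Set
    Spanned l = InRange l × vertex T l ∈ S

    P<N : ∀ {p} → p ∈ P → p < N
    P<N p∈P = proj₁ (P-valid p∈P)

    apex-spanned : ∀ {p} → p ∈ P → Spanned (apex o p)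
    apex-spanned {p} p∈P = apex-InRange o p , P-in-S p∈P ∈T₁

    rim-spanned : ∀ {p} → p ∈ P → Spanned (rim p)
    rim-spanned p∈P = P<N p∈P , P-in-S p∈P ∈T₂

    nexts : List Place
    nexts = map (λ p → rim (next p)) P

    nexts⁻ : ∀ {l} → l ∈ nexts → Σ ℕ λ p → p ∈ P × l ≡ rim (next p)
    nexts⁻ = ∈-map⁻ _

    nexts-spanned : ∀ {l} → l ∈ nexts → Spanned l
    nexts-spanned l∈ with nexts⁻ l∈
    ... | p , p∈P , refl = next<N p , P-in-S p∈P ∈T₃

    Block : Set
    Block = Σ (List (V n g)) λ X → SphereVerticesIn T S X × length P + 3 ≤ length X

    three-and-nexts : ∀ {x y z} → Distinct₃ (x , y , z) → (∀ {l} → l ∈ nexts → x ≢ l × y ≢ l × z ≢ l) →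
                      Spanned x → Spanned y → Spanned z → Block
    three-and-nexts {x} {y} {z} (x≢y , y≢z , x≢z) fresh sx sy sz =
      map (vertex T) Ls ,
      (unique-map⁺ (vertex T) (λ l∈ l'∈ → vertex-injective T (proj₁ (spanned l∈)) (proj₁ (spanned l'∈))) Ls-unique ,
       (λ w∈ → let (l , l∈ , w≡) = ∈-map⁻ (vertex T) w∈ in subst (_∈ S) (sym w≡) (proj₂ (spanned l∈))) ,
       (λ w∈ → let (l , l∈ , w≡) = ∈-map⁻ (vertex T) w∈ in l , proj₁ (spanned l∈) , w≡)) ,
      ≤-reflexive (trans (+-comm (length P) 3) (cong (3 +_) (sym (trans (length-map (vertex T) nexts) (length-map _ P)))))
      where
      Ls = x ∷ y ∷ z ∷ nexts
      Ls-unique : Unique Ls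
      Ls-unique =
        (x≢y ∷ x≢z ∷ All.tabulate (λ l∈ → proj₁ (fresh l∈))) ∷
        (y≢z ∷ All.tabulate (λ l∈ → proj₁ (proj₂ (fresh l∈)))) ∷
        All.tabulate (λ l∈ → proj₂ (proj₂ (fresh l∈))) ∷
        unique-map⁺ _ (λ p∈ p'∈ e → next-injective (P<N p∈) (P<N p'∈) (rim-injective e)) P-unique
      spanned : ∀ {l} → l ∈ Ls → Spanned l
      spanned (here refl) = sx
      spanned (there (here refl)) = sy
      spanned (there (there (here refl))) = sz
      spanned (there (there (there l∈))) = nexts-spanned l∈

    -- The common apex, the vertices b_{p+1} of two of the triangles, and all the b_{p+2}.
    same-parity-block : ∀ {p₁ p₂} → p₁ ∈ P → p₂ ∈ P → p₁ ≢ p₂ → All (λ p → ev p ≡ ev p₁) P → Block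
    same-parity-block {p₁} p₁∈P p₂∈P p₁≢p₂ same-parity = three-and-nexts
      (apex≢rim o p₁ , (λ e → p₁≢p₂ (rim-injective e)) , apex≢rim o p₁)
      (λ l∈ → let (p , p∈P , l≡) = nexts⁻ l∈ in
        (λ e → apex≢rim o p₁ (trans e l≡)) ,
        (λ e → next-parity p∈P p₁∈P (rim-injective (trans e l≡))) ,
        (λ e → next-parity p∈P p₂∈P (rim-injective (trans e l≡))))
      (apex-spanned p₁∈P) (rim-spanned p₁∈P) (rim-spanned p₂∈P)
      where
      next-parity : ∀ {p q} → p ∈ P → q ∈ P → q ≢ next p
      next-parity p∈P q∈P q≡ = not-¬ refl (trans (sym (All.lookup same-parity q∈P))
        (trans (cong ev q≡) (trans (ev-next (P<N p∈P)) (cong not (All.lookup same-parity p∈P)))))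

    -- Both apices, the first vertex b_{s+1} of an arc of positions, and all the b_{p+2}.
    mixed-parity-block : ∀ {p₁ p₃ q} → p₁ ∈ P → p₃ ∈ P → ev p₃ ≢ ev p₁ → q < N → q ∉ P → Block
    mixed-parity-block {p₁} {p₃} p₁∈P p₃∈P p₃≢p₁ q<N q∉P with arc-start P (P<N p₁∈P) q<N p₁∈P q∉P
    ... | s , s∈P , s<N , prev-s∉P = three-and-nexts {apex-a} {apex-c} {rim s}
      ((λ ()) , (λ ()) , (λ ()))
      (λ l∈ → let (p , p∈P , l≡) = nexts⁻ l∈ in
        (λ e → case trans e l≡ of λ ()) , (λ e → case trans e l≡ of λ ()) ,
        (λ e → prev-s∉P (subst (_∈ P) (next-injective (P<N p∈P) (prev<N s<N)
          (trans (sym (rim-injective (trans e l≡))) (sym (next-prev s<N)))) p∈P)))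
      (proj₁ apices-spanned) (proj₂ apices-spanned) (rim-spanned s∈P)
      where
      apices-spanned : Spanned apex-a × Spanned apex-c
      apices-spanned with apex-cases o p₁ | apex-cases o p₃
      ... | inj₁ a₁ | inj₂ c₃ = subst Spanned a₁ (apex-spanned p₁∈P) , subst Spanned c₃ (apex-spanned p₃∈P)
      ... | inj₂ c₁ | inj₁ a₃ = subst Spanned a₃ (apex-spanned p₃∈P) , subst Spanned c₁ (apex-spanned p₁∈P)
      ... | inj₁ a₁ | inj₁ a₃ = ⊥-elim (p₃≢p₁ (apex-parity o (trans a₃ (sym a₁))))
      ... | inj₂ c₁ | inj₂ c₃ = ⊥-elim (p₃≢p₁ (apex-parity o (trans c₃ (sym c₁))))

    whole-cycle-too-large : length S ≤ g → ¬ All (_∈ P) (upTo N)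
    whole-cycle-too-large S≤g whole-cycle = <⇒≱ (m<m+n g (s≤s z≤n)) (≤-trans N≤|S| S≤g)
      where
      N≤|S| : N ≤ length S
      N≤|S| = subst (_≤ length S) (trans (length-map (rimV T) (upTo N)) (length-upTo N))
        (unique-⊆⇒length-≤ (unique-map⁺ (rimV T) (λ q∈ q'∈ → rimV-injective T (∈-upTo⁻ q∈) (∈-upTo⁻ q'∈)) (upTo⁺ N))
          (λ w∈ → let (q , q∈ , w≡) = ∈-map⁻ (rimV T) w∈ in
            subst (_∈ S) (sym w≡) (proj₂ (rim-spanned (All.lookup whole-cycle q∈)))))

    sphere-block : length S ≤ g → 2 ≤ length P → Block
    sphere-block S≤g 2≤|P| with unique-distinct-pair P-unique 2≤|P|
    ... | p₁ , p₂ , p₁∈P , p₂∈P , p₁≢p₂ with all? (λ p → ev p Bool.≟ ev p₁) P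
    ...   | yes same-parity = same-parity-block p₁∈P p₂∈P p₁≢p₂ same-parity
    ...   | no mixed with find (¬All⇒Any¬ (λ p → ev p Bool.≟ ev p₁) P mixed)
    ...     | p₃ , p₃∈P , p₃≢p₁ with all? (_∈? P) (upTo N)
    ...       | yes whole-cycle = ⊥-elim (whole-cycle-too-large S≤g whole-cycle)
    ...       | no gap with find (¬All⇒Any¬ (_∈? P) (upTo N) gap)
    ...         | q , q∈ , q∉P = mixed-parity-block p₁∈P p₃∈P p₃≢p₁ (∈-upTo⁻ q∈) q∉P

module Construction (n h : ℕ) (lab : Triple n → Fin n × Fin n × Fin n)
  (lab-ok : ∀ T → IsLabelling (proj₁ T) (lab T))
  (L : SimpleGraph (Fin n)) (DL : List (Tri (Fin n)))
  (DL-ok : IsTriangleDecomposition (SimpleGraph.Adj L) DL) where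

  open SphereDecompositions n h lab lab-ok

  Adj : Fin n → Fin n → Set
  Adj = SimpleGraph.Adj L

  InL : Triple n → Set
  InL T = Any (_≋ proj₁ T) DL

  InL? : ∀ T → Dec (InL T)
  InL? T = Any.any? (λ t → ≋-dec F._≟_ t (proj₁ T)) DL

  orientation : Triple n → Bool
  orientation T = does (InL? T)

  InL-adjacent : ∀ {T x y} → InL T → x ∈T proj₁ T → y ∈T proj₁ T → x ≢ y → Adj x y
  InL-adjacent T∈ x∈T y∈T x≢y =
    triangle-adjacent (SimpleGraph.sym L) (proj₂ (All.lookup (proj₁ DL-ok) (∈-lookup (Any.index T∈))))
      (⊆₃-∈ (proj₂ t≋T) x∈T) (⊆₃-∈ (proj₂ t≋T) y∈T) x≢y
    where
    t≋T = lookup-index T∈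

  InL-edge-unique : ∀ {T T' x y} → InL T → InL T' → x ≢ y →
    x ∈T proj₁ T → y ∈T proj₁ T → x ∈T proj₁ T' → y ∈T proj₁ T' → T ≡ T'
  InL-edge-unique {T} {T'} {x} {y} T∈ T'∈ x≢y x∈T y∈T x∈T' y∈T' =
    Triple-≋⇒≡ T T' (⊆₃-trans (proj₂ t≋T) (subst (_⊆₃ proj₁ T') (sym same) (proj₁ t'≋T')) ,
                     ⊆₃-trans (proj₂ t'≋T') (subst (_⊆₃ proj₁ T) same (proj₁ t≋T)))
    where
    t≋T = lookup-index T∈
    t'≋T' = lookup-index T'∈
    same : lookup DL (Any.index T∈) ≡ lookup DL (Any.index T'∈)
    same = cong (lookup DL) (proj₂ (proj₂ DL-ok x y (InL-adjacent {T} T∈ x∈T y∈T x≢y)) (Any.index T∈) (Any.index T'∈)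
      (⊆₃-∈ (proj₂ t≋T) x∈T , ⊆₃-∈ (proj₂ t≋T) y∈T) (⊆₃-∈ (proj₂ t'≋T') x∈T' , ⊆₃-∈ (proj₂ t'≋T') y∈T'))

  -- (T , p) codes the triangle at position p of the chosen decomposition of the sphere of T.
  Code : Set
  Code = Triple n × ℕ

  Valid : Code → Set
  Valid (T , p) = ValidPos (orientation T) p

  ▵ : Code → Tri (V n g)
  ▵ (T , p) = triangle (orientation T) T p

  ∈▵⇒On : ∀ c {w} → w ∈T ▵ c → Σ Place λ l → On (orientation (proj₁ c)) (proj₂ c) l × w ≡ vertex (proj₁ c) l
  ∈▵⇒On (T , p) = ∈-triangle⇒On (orientation T) T p

  OldOn : Code → V n g → Set
  OldOn (T , p) w = Σ Place λ l → IsOld l × On (orientation T) p l × w ≡ vertex T l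

  owner-on-▵ : ∀ {c w} → Valid c → w ∈T ▵ c → owner w ≡ just (proj₁ c) ⊎ (owner w ≡ nothing × OldOn c w)
  owner-on-▵ {T , p} (p<N , _) w∈ with ∈▵⇒On (T , p) w∈
  ... | l , on , refl with owner-vertex T (On-InRange (orientation T) p<N on)
  ...   | inj₁ owned = inj₁ owned
  ...   | inj₂ (unowned , is-old) = inj₂ (unowned , l , is-old , on , refl)

  owners-agree : ∀ {w T T'} {X Y : Set} → owner w ≡ just T ⊎ (owner w ≡ nothing × X) →
    owner w ≡ just T' ⊎ (owner w ≡ nothing × Y) → T ≡ T' ⊎ (X × Y)
  owners-agree (inj₁ o) (inj₁ o') = inj₁ (just-injective (trans (sym o) o'))
  owners-agree (inj₁ o) (inj₂ (o' , _)) with () ← trans (sym o) o'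
  owners-agree (inj₂ (o , _)) (inj₁ o') with () ← trans (sym o) o'
  owners-agree (inj₂ (_ , x)) (inj₂ (_ , y)) = inj₂ (x , y)

  old-pair-InL : ∀ {c u v} → Valid c → u ≢ v → OldOn c u → OldOn c v → InL (proj₁ c)
  old-pair-InL {T , p} valid u≢v (l , is-old , on , refl) (l' , is-old' , on' , refl) with InL? T
  ... | yes T∈ = T∈
  ... | no _ with () ← old-pair⇒in valid (λ { refl → u≢v refl }) is-old is-old' on on'

  OldOn-∈T : ∀ {c w} → OldOn c w → Σ (Fin n) λ x → w ≡ old x × x ∈T proj₁ (proj₁ c)
  OldOn-∈T {T , _} (l , is-old , _ , refl) = old-vertex T is-old

  shared-old-pair⇒same-sphere : ∀ {c c' u v} → Valid c → Valid c' → u ≢ v →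
    OldOn c u → OldOn c v → OldOn c' u → OldOn c' v → proj₁ c ≡ proj₁ c'
  shared-old-pair⇒same-sphere {c} {c'} vc vc' u≢v ou ov ou' ov'
    with OldOn-∈T ou | OldOn-∈T ov | OldOn-∈T ou' | OldOn-∈T ov'
  ... | x , refl , x∈T | y , refl , y∈T | x' , x≡ , x'∈T' | y' , y≡ , y'∈T'
    with refl ← old-injective x≡ | refl ← old-injective y≡ =
    InL-edge-unique (old-pair-InL vc u≢v ou ov) (old-pair-InL vc' u≢v ou' ov') (λ { refl → u≢v refl })
      x∈T y∈T x'∈T' y'∈T'

  -- A shared new vertex determines the sphere, and two shared vertices of Z force both spheres
  -- to be triangles of L sharing an edge.
  shared-pair⇒same-code : ∀ {c c' u v} → Valid c → Valid c' → u ≢ v →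
    u ∈T ▵ c → v ∈T ▵ c → u ∈T ▵ c' → v ∈T ▵ c' → c ≡ c'
  shared-pair⇒same-code {T , p} {T' , p'} {u} {v} vc vc' u≢v u∈ v∈ u∈' v∈' with same-sphere
    where
    same-sphere : T ≡ T'
    same-sphere with owners-agree (owner-on-▵ vc u∈) (owner-on-▵ vc' u∈') | owners-agree (owner-on-▵ vc v∈) (owner-on-▵ vc' v∈')
    ... | inj₁ T≡T' | _ = T≡T'
    ... | inj₂ _ | inj₁ T≡T' = T≡T'
    ... | inj₂ (ou , ou') | inj₂ (ov , ov') = shared-old-pair⇒same-sphere vc vc' u≢v ou ov ou' ov'
  ... | refl with ∈▵⇒On (T , p) u∈ | ∈▵⇒On (T , p) v∈ | ∈▵⇒On (T , p') u∈' | ∈▵⇒On (T , p') v∈'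
  ...   | l , on-l , refl | m , on-m , refl | l' , on-l' , l≡ | m' , on-m' , m≡ =
    cong (T ,_) (On-determines (orientation T) (proj₁ vc) (proj₁ vc') (λ { refl → u≢v refl }) on-l on-m
      (subst (On (orientation T) p') (sym l≡l') on-l') (subst (On (orientation T) p') (sym m≡m') on-m'))
    where
    l≡l' : l ≡ l'
    l≡l' = vertex-injective T (On-InRange (orientation T) (proj₁ vc) on-l) (On-InRange (orientation T) (proj₁ vc') on-l') l≡
    m≡m' : m ≡ m'
    m≡m' = vertex-injective T (On-InRange (orientation T) (proj₁ vc) on-m) (On-InRange (orientation T) (proj₁ vc') on-m') m≡

  E : V n g → V n g → Set
  E = UnionE L

  old-pair-edge : ∀ {T p l l'} → Valid (T , p) → l ≢ l' → IsOld l → IsOld l' →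
    On (orientation T) p l → On (orientation T) p l' → E (vertex T l) (vertex T l')
  old-pair-edge {T} {p} {l} {l'} valid l≢l' ol ol' on on' with old-vertex T ol | old-vertex T ol'
  ... | x , x≡ , x∈T | y , y≡ , y∈T =
    subst₂ E (sym x≡) (sym y≡) (inj₁ (InL-adjacent {T}
      (old-pair-InL {T , p} valid u≢v (l , ol , on , refl) (l' , ol' , on' , refl))
      x∈T y∈T (λ x≡y → u≢v (trans x≡ (trans (cong old x≡y) (sym y≡))))))
    where
    u≢v : vertex T l ≢ vertex T l'
    u≢v e = l≢l' (vertex-injective T (On-InRange (orientation T) (proj₁ valid) on) (On-InRange (orientation T) (proj₁ valid) on') e)

  apex-rim-edge : ∀ {T p q} → Valid (T , p) → On (orientation T) p (rim q) → E (vertex T (apex (orientation T) p)) (rimV T q)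
  apex-rim-edge {T} {p} {q} valid on with apex-cases (orientation T) p
  ... | inj₂ c = subst (λ l → E (vertex T l) (rimV T q)) (sym c) (inj₂ (inj₁ (e-cb (IsB-rimV T q<N))))
    where q<N = On-InRange (orientation T) (proj₁ valid) on
  ... | inj₁ a = subst (λ l → E (vertex T l) (rimV T q)) (sym a) (a-edge q on)
    where
    a-edge : ∀ q → On (orientation T) p (rim q) → E (aV T) (rimV T q)
    a-edge zero on = old-pair-edge valid (λ ()) old-a old-b₁ (inj₁ (sym a)) on
    a-edge (suc zero) on = old-pair-edge valid (λ ()) old-a old-b₂ (inj₁ (sym a)) on
    a-edge (suc (suc k)) on =
      inj₂ (inj₁ (e-ab (s≤s (s≤s (s≤s z≤n))) (IsB-rimV T (On-InRange (orientation T) (proj₁ valid) on))))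

  rim-rim-edge : ∀ {T p} → Valid (T , p) → E (rimV T p) (rimV T (next p))
  rim-rim-edge {T} {p} valid@(p<N , _) with suc<N⊎last p<N
  ... | inj₂ last rewrite next-last last = inj₂ (inj₁ (e-wrap (IsB-rimV≡ T p<N (sym last)) isB₁))
  ... | inj₁ s<N rewrite next-suc s<N = interior p valid s<N
    where
    interior : ∀ p → Valid (T , p) → suc p < N → E (rimV T p) (rimV T (suc p))
    interior zero valid 1<N =
      old-pair-edge valid (λ ()) old-b₁ old-b₂ (inj₂ (inj₁ refl)) (inj₂ (inj₂ (cong rim (sym (next-suc 1<N)))))
    interior (suc _) (p<N , _) s<N = inj₂ (inj₁ (e-bb (s≤s (s≤s z≤n)) (IsB-rimV T p<N) (IsB-rimV T s<N)))

  ▵-proper : ∀ {c} → Valid c → let (x , y , z) = ▵ c in (x ≢ y × y ≢ z × x ≢ z) × (E x y × E y z × E x z)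
  ▵-proper {T , p} valid =
    triangle-distinct (orientation T) T (proj₁ valid) ,
    apex-rim-edge valid (inj₂ (inj₁ refl)) , rim-rim-edge valid , apex-rim-edge valid (inj₂ (inj₂ refl))

  Covered : V n g → V n g → Set
  Covered u v = Σ Code λ c → Valid c × u ∈T ▵ c × v ∈T ▵ c

  Covered-sym : ∀ {u v} → Covered u v → Covered v u
  Covered-sym (c , valid , u∈ , v∈) = c , valid , v∈ , u∈

  covered-at : ∀ T {p l l'} → Covers (orientation T) p l l' → Covered (vertex T l) (vertex T l')
  covered-at T {p} (valid , on , on') =
    (T , p) , valid , On⇒∈-triangle {orientation T} {T} {p} on , On⇒∈-triangle {orientation T} {T} {p} on'

  L-edge-covered : ∀ {x y} → Adj x y → Covered (old x) (old y)
  L-edge-covered {x} {y} xy with proj₁ (proj₂ DL-ok x y xy)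
  ... | i , x∈t , y∈t with sort (lookup DL i) (proj₁ (All.lookup (proj₁ DL-ok) (∈-lookup i)))
  ...   | T , t≋T with old-place T (⊆₃-∈ (proj₁ t≋T) x∈t) | old-place T (⊆₃-∈ (proj₁ t≋T) y∈t)
  ...     | l , ol , x≡ | l' , ol' , y≡ with old-pair-covered ol ol' l≢l'
    where
    l≢l' : l ≢ l'
    l≢l' refl = SimpleGraph.irrefl L (subst (Adj x) (old-injective (trans y≡ (sym x≡))) xy)
  ...       | p , covers = subst₂ Covered (sym x≡) (sym y≡) (covered-at T (subst (λ o → Covers o p l l') (sym in-L) covers))
    where
    in-L : orientation T ≡ true
    in-L = dec-true (InL? T) (Any.map (λ { refl → t≋T }) (∈-lookup {xs = DL} i))

  sphere-edge-covered : ∀ {u v} → SphereEdge u v → Covered u v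
  sphere-edge-covered (e-ab {T} 3≤j isB) with IsB⇒rimV isB
  ... | q , refl , q<N , refl with a-rim-covered (orientation T) (≤-pred 3≤j) q<N
  ...   | p , covers = covered-at T covers
  sphere-edge-covered (e-cb {T} isB) with IsB⇒rimV isB
  ... | q , refl , q<N , refl with c-rim-covered (orientation T) q<N
  ...   | p , covers = covered-at T covers
  sphere-edge-covered (e-bb {T} 2≤j isB isB') with IsB⇒rimV isB | IsB⇒rimV isB'
  ... | q , refl , q<N , refl | _ , refl , s<N , refl =
    covered-at T {q} ((q<N , λ _ → ≤-pred 2≤j) , inj₂ (inj₁ refl) , inj₂ (inj₂ (cong rim (sym (next-suc s<N)))))
  sphere-edge-covered (e-wrap {T} isB isB₁) with IsB⇒rimV isB
  ... | q , last , q<N , refl =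
    covered-at T {q} ((q<N , λ _ → 0<q) , inj₂ (inj₁ refl) , inj₂ (inj₂ (cong rim (sym (next-last (sym last))))))
    where
    0<q : 0 < q
    0<q = subst (0 <_) (suc-injective last) (s≤s z≤n)

  edge-covered : ∀ {u v} → E u v → Covered u v
  edge-covered {old x} {old y} (inj₁ xy) = L-edge-covered xy
  edge-covered (inj₂ (inj₁ uv)) = sphere-edge-covered uv
  edge-covered (inj₂ (inj₂ vu)) = Covered-sym (sphere-edge-covered vu)

  sphere-edge-irreflexive : ∀ {u v} → SphereEdge u v → u ≢ v
  sphere-edge-irreflexive (e-ab {T} _ isB) u≡v with IsB⇒rimV isB
  ... | q , _ , q<N , v≡ = a≢rimV T q<N (trans u≡v v≡)
  sphere-edge-irreflexive (e-cb {T} isB) u≡v with IsB⇒rimV isB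
  ... | q , _ , q<N , v≡ = c≢rimV T q<N (trans u≡v v≡)
  sphere-edge-irreflexive (e-bb {T} _ isB isB') u≡v with IsB⇒rimV isB | IsB⇒rimV isB'
  ... | q , refl , q<N , u≡ | _ , refl , s<N , v≡ =
    <-irrefl (rimV-injective T q<N s<N (trans (sym u≡) (trans u≡v v≡))) (n<1+n q)
  sphere-edge-irreflexive (e-wrap {T} isB isB₁) u≡v with IsB⇒rimV isB
  ... | _ , refl , q<N , u≡ with () ← rimV-injective T q<N (s≤s z≤n) (trans (sym u≡) u≡v)

  edge-irreflexive : ∀ {u v} → E u v → u ≢ v
  edge-irreflexive {old x} {old y} (inj₁ xy) refl = SimpleGraph.irrefl L xy
  edge-irreflexive (inj₂ (inj₁ uv)) = sphere-edge-irreflexive uv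
  edge-irreflexive (inj₂ (inj₂ vu)) u≡v = sphere-edge-irreflexive vu (sym u≡v)

  valid? : ∀ c → Dec (Valid c)
  valid? (T , p) = (p <? N) ×-dec ((orientation T Bool.≟ false) →-dec (0 <? p))

  codes : List Code
  codes = filter valid? (cartesianProduct allTriples (upTo N))

  codes-unique : Unique codes
  codes-unique = filter⁺ valid? (cartesianProduct⁺ allTriples-unique (upTo⁺ N))

  ∈-codes : ∀ {c} → Valid c → c ∈ codes
  ∈-codes {T , p} valid = ∈-filter⁺ valid? (∈-cartesianProduct⁺ (∈-allTriples T) (∈-upTo⁺ (proj₁ valid))) valid

  codes-valid : ∀ {c} → c ∈ codes → Valid c
  codes-valid c∈ = proj₂ (∈-filter⁻ valid? {xs = cartesianProduct allTriples (upTo N)} c∈)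

  ▵-injective : ∀ {c c'} → Valid c → Valid c' → ▵ c ≡ ▵ c' → c ≡ c'
  ▵-injective {c} valid valid' eq =
    shared-pair⇒same-code valid valid' (proj₁ (proj₂ (proj₁ (▵-proper {c} valid)))) ∈T₂ ∈T₃
      (subst (_ ∈T_) eq ∈T₂) (subst (_ ∈T_) eq ∈T₃)

  D : List (Tri (V n g))
  D = map ▵ codes

  D-unique : Unique D
  D-unique = unique-map⁺ ▵ (λ c∈ c'∈ → ▵-injective (codes-valid c∈) (codes-valid c'∈)) codes-unique

  decode : (i : Fin (length D)) → Σ Code λ c → Valid c × lookup D i ≡ ▵ c
  decode i with ∈-map⁻ ▵ (∈-lookup {xs = D} i)
  ... | c , c∈ , eq = c , codes-valid c∈ , eq

  index-of : ∀ {c} → Valid c → Σ (Fin (length D)) λ i → lookup D i ≡ ▵ c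
  index-of valid = Any.index c∈D , sym (lookup-index c∈D)
    where c∈D = ∈-map⁺ ▵ (∈-codes valid)

  D-decomposition : IsTriangleDecomposition E D
  D-decomposition = map⁺ (All.tabulate (λ c∈ → ▵-proper (codes-valid c∈))) , covered-once
    where
    covered-once : ∀ u v → E u v → Σ (Fin (length D)) (λ i → EdgeIn u v (lookup D i))
                                  × (∀ i j → EdgeIn u v (lookup D i) → EdgeIn u v (lookup D j) → i ≡ j)
    covered-once u v uv with edge-covered uv
    ... | c , valid , u∈ , v∈ with index-of valid
    ...   | i , i↦c = (i , subst (EdgeIn u v) (sym i↦c) (u∈ , v∈)) , unique
      where
      unique : ∀ i j → EdgeIn u v (lookup D i) → EdgeIn u v (lookup D j) → i ≡ j
      unique i j (u∈i , v∈i) (u∈j , v∈j) with decode i | decode j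
      ... | ci , vi , i↦ci | cj , vj , j↦cj =
        unique-lookup-injective D-unique i j (trans i↦ci (trans (cong ▵ same) (sym j↦cj)))
        where
        same : ci ≡ cj
        same = shared-pair⇒same-code vi vj (edge-irreflexive uv)
          (subst (u ∈T_) i↦ci u∈i) (subst (v ∈T_) i↦ci v∈i) (subst (u ∈T_) j↦cj u∈j) (subst (v ∈T_) j↦cj v∈j)

  D-in-C : All InC D
  D-in-C = map⁺ (All.tabulate λ { {T , p} c∈ →
    T , ▵ (T , p) , triangle-InB (orientation T) T (codes-valid c∈) , λ _ → (λ w∈ → w∈) , (λ w∈ → w∈) })

  -- Girth

  open Union V-≟
  open import Data.List.Membership.DecPropositional V-≟ using (_∈?_)

  Unowned : V n g → Set
  Unowned w = owner w ≡ nothing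

  unowned? : ∀ w → Dec (Unowned w)
  unowned? (old _) = yes refl
  unowned? (bnew _ _) = no λ ()
  unowned? (cnew _) = no λ ()

  olds : List (V n g) → List (V n g)
  olds = filter unowned?

  OfSphere : Triple n → List (V n g) → Set
  OfSphere T X = ∀ {w} → w ∈ X → owner w ≡ just T ⊎ Unowned w

  OwnedIn : List (Triple n) → List (V n g) → Set
  OwnedIn ts W = ∀ {w T} → w ∈ W → owner w ≡ just T → T ∈ ts

  common-olds : ∀ {ts T W X} → T ∉ ts → OwnedIn ts W → OfSphere T X →
    ∀ {w} → w ∈ common W X → w ∈ olds W × w ∈ olds X
  common-olds {W = W} {X} T∉ts owned ofT w∈ with ∈-filter⁻ (_∈? W) {xs = X} w∈
  ... | w∈X , w∈W with ofT w∈X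
  ...   | inj₁ owned-by-T = ⊥-elim (T∉ts (owned w∈W owned-by-T))
  ...   | inj₂ unowned = ∈-filter⁺ unowned? w∈W unowned , ∈-filter⁺ unowned? w∈X unowned

  common-unique : ∀ {W X} → Unique X → Unique (common W X)
  common-unique {W} = filter⁺ (_∈? W)

  corners : Code → List (V n g)
  corners c = proj₁ (▵ c) ∷ proj₁ (proj₂ (▵ c)) ∷ proj₂ (proj₂ (▵ c)) ∷ []

  corners-unique : ∀ {c} → Valid c → Unique (corners c)
  corners-unique {c} valid with proj₁ (▵-proper {c} valid)
  ... | x≢y , y≢z , x≢z = (x≢y ∷ x≢z ∷ []) ∷ (y≢z ∷ []) ∷ [] ∷ []

  ∈-corners⁻ : ∀ {c w} → w ∈ corners c → w ∈T ▵ c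
  ∈-corners⁻ (here refl) = ∈T₁
  ∈-corners⁻ (there (here refl)) = ∈T₂
  ∈-corners⁻ (there (there (here refl))) = ∈T₃

  ∈-corners⁺ : ∀ {c w} → w ∈T ▵ c → w ∈ corners c
  ∈-corners⁺ (inj₁ refl) = here refl
  ∈-corners⁺ (inj₂ (inj₁ refl)) = there (here refl)
  ∈-corners⁺ (inj₂ (inj₂ refl)) = there (there (here refl))

  corners-OfSphere : ∀ {c} → Valid c → OfSphere (proj₁ c) (corners c)
  corners-OfSphere {c} valid w∈ with owner-on-▵ {c} valid (∈-corners⁻ w∈)
  ... | inj₁ owned = inj₁ owned
  ... | inj₂ (unowned , _) = inj₂ unowned

  -- Every triangle has a new vertex.
  corners-olds : ∀ {c} → Valid c → length (olds (corners c)) ≤ 2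
  corners-olds {T , p} valid with triangle-new-vertex (orientation T) T valid
  ... | w , w∈ , owned = ≤-pred (filter-notAll unowned? (corners (T , p))
    (lose (∈-corners⁺ {T , p} w∈) λ unowned → case trans (sym owned) unowned of λ ()))

  module SpanBound (S : List (V n g)) (S≤g : length S ≤ g)
    (K : List Code) (K-unique : Unique K) (K-valid : ∀ {c} → c ∈ K → Valid c)
    (K-in-S : ∀ {c} → c ∈ K → ∀ {w} → w ∈T ▵ c → w ∈ S) where

    open import Data.List.Membership.DecPropositional (Triple-≟ {n}) using () renaming (_∈?_ to _∈ₜ?_)

    K-on : List (Triple n) → List Code
    K-on ts = filter (λ c → proj₁ c ∈ₜ? ts) K

    K-at : Triple n → List Code
    K-at T = filter (λ c → Triple-≟ (proj₁ c) T) K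

    length-K-on-∷ : ∀ {T ts} → T ∉ ts → length (K-on (T ∷ ts)) ≡ length (K-at T) + length (K-on ts)
    length-K-on-∷ {T} {ts} T∉ts =
      length-filter-⊎ (λ c → Triple-≟ (proj₁ c) T) (λ c → proj₁ c ∈ₜ? ts) (λ c → proj₁ c ∈ₜ? (T ∷ ts))
        (λ { (here e) → inj₁ e ; (there m) → inj₂ m }) here there (λ { refl m → T∉ts m }) K

    corners-⊆ : ∀ {c} → c ∈ K → corners c ⊆ S
    corners-⊆ c∈K w∈ = K-in-S c∈K (∈-corners⁻ w∈)

    -- The vertices in S spanned by the triangles of K on the spheres of ts, and on the sphere of T.
    data Span (ts : List (Triple n)) : Set where
      none : length (K-on ts) ≡ 0 → Span ts
      one : ∀ {c} → c ∈ K → proj₁ c ∈ ts → length (K-on ts) ≡ 1 → Span ts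
      many : ∀ {W} → Unique W → W ⊆ S → OwnedIn ts W → length (K-on ts) + 3 ≤ length W → Span ts

    data Piece (T : Triple n) : Set where
      none : length (K-at T) ≡ 0 → Piece T
      one : ∀ {c} → c ∈ K → proj₁ c ≡ T → length (K-at T) ≡ 1 → Piece T
      many : ∀ {X} → SphereVerticesIn T S X → length (K-at T) + 3 ≤ length X → Piece T

    many-piece : ∀ T → 2 ≤ length (K-at T) → Piece T
    many-piece T 2≤ = many (proj₁ (proj₂ block)) (subst (λ k → k + 3 ≤ length (proj₁ block)) |P| (proj₂ (proj₂ block)))
      where
      P = map proj₂ (K-at T)
      |P| : length P ≡ length (K-at T)
      |P| = length-map proj₂ (K-at T)
      in-T : ∀ {c} → c ∈ K-at T → c ∈ K × proj₁ c ≡ T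
      in-T = ∈-filter⁻ _ {xs = K}
      P-unique : Unique P
      P-unique = unique-map⁺ proj₂ (λ c∈ c'∈ p≡ → cong₂ _,_ (trans (proj₂ (in-T c∈)) (sym (proj₂ (in-T c'∈)))) p≡)
                   (filter⁺ _ K-unique)
      P⊆K : ∀ {p} → p ∈ P → (T , p) ∈ K
      P⊆K p∈ with ∈-map⁻ proj₂ p∈
      ... | (T' , p) , c∈ , refl with in-T c∈
      ...   | c∈K , refl = c∈K
      block = SphereBlock.sphere-block (orientation T) T S P P-unique (λ p∈ → K-valid (P⊆K p∈)) (λ p∈ → K-in-S (P⊆K p∈))
                S≤g (subst (2 ≤_) (sym |P|) 2≤)

    piece : ∀ T → Piece T
    piece T with length-cases (K-at T)
    ... | inj₁ empty = none empty
    ... | inj₂ (inj₁ (c , c∈ , single)) = let (c∈K , c≡T) = ∈-filter⁻ _ {xs = K} c∈ in one c∈K c≡T single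
    ... | inj₂ (inj₂ 2≤) = many-piece T 2≤

    sphere-OfSphere : ∀ {T X} → SphereVerticesIn T S X → OfSphere T X
    sphere-OfSphere {T} (_ , _ , place) w∈ with place w∈
    ... | l , in-range , refl with owner-vertex T in-range
    ...   | inj₁ owned = inj₁ owned
    ...   | inj₂ (unowned , _) = inj₂ unowned

    sphere-olds : ∀ {T X} → SphereVerticesIn T S X → length (olds X) ≤ 3
    sphere-olds {T} {X} (X-unique , _ , place) =
      unique-⊆⇒length-≤ (filter⁺ unowned? X-unique) old∈
      where
      old∈ : olds X ⊆ old-vertices T
      old∈ w∈ with ∈-filter⁻ unowned? {xs = X} w∈
      ... | w∈X , unowned with place w∈X
      ...   | l , in-range , refl with owner-vertex T in-range
      ...     | inj₁ owned with () ← trans (sym owned) unowned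
      ...     | inj₂ (_ , is-old) = old-vertex-∈ T is-old

    merge : ∀ {T ts W X e e' c} → T ∉ ts → Unique W → W ⊆ S → OwnedIn ts W → Unique X → X ⊆ S → OfSphere T X →
      length (K-on ts) + e ≤ length W → length (K-at T) + e' ≤ length X → length (common W X) ≤ c → c + 3 ≤ e + e' →
      Span (T ∷ ts)
    merge {T} {ts} {W} {X} {e} {e'} {c} T∉ts W-unique W⊆S W-owned X-unique X⊆S X-of-T W-bound X-bound common≤ c+3≤ =
      many (∪-unique W-unique X-unique) ∪⊆S owned
        (subst (λ k → k + 3 ≤ length (W ∪ X)) (sym (length-K-on-∷ T∉ts))
          (length-∪-bound {length (K-on ts)} {length (K-at T)} {e} {e'} {c} W X W-bound X-bound common≤ c+3≤))
      where
      ∪⊆S : W ∪ X ⊆ S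
      ∪⊆S w∈ with ∈-∪⁻ W w∈
      ... | inj₁ w∈W = W⊆S w∈W
      ... | inj₂ w∈X = X⊆S w∈X
      owned : OwnedIn (T ∷ ts) (W ∪ X)
      owned w∈ o with ∈-∪⁻ W w∈
      ... | inj₁ w∈W = there (W-owned w∈W o)
      ... | inj₂ w∈X with X-of-T w∈X
      ...   | inj₁ o' = here (just-injective (trans (sym o) o'))
      ...   | inj₂ unowned with () ← trans (sym o) unowned

    common≤olds : ∀ {T ts W X} → T ∉ ts → OwnedIn ts W → Unique X → OfSphere T X →
      length (common W X) ≤ length (olds W) × length (common W X) ≤ length (olds X)
    common≤olds T∉ts W-owned X-unique X-of-T =
      unique-⊆⇒length-≤ (common-unique X-unique) (λ w∈ → proj₁ (common-olds T∉ts W-owned X-of-T w∈)) ,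
      unique-⊆⇒length-≤ (common-unique X-unique) (λ w∈ → proj₂ (common-olds T∉ts W-owned X-of-T w∈))

    corners-OwnedIn : ∀ {c ts} → c ∈ K → proj₁ c ∈ ts → OwnedIn ts (corners c)
    corners-OwnedIn c∈K c∈ts w∈ o with corners-OfSphere (K-valid c∈K) w∈
    ... | inj₁ o' = subst (_∈ _) (just-injective (trans (sym o') o)) c∈ts
    ... | inj₂ unowned with () ← trans (sym o) unowned

    -- Two triangles of D share no edge.
    corners-common≤1 : ∀ {c c'} → c ∈ K → c' ∈ K → proj₁ c ≢ proj₁ c' → length (common (corners c) (corners c')) ≤ 1
    corners-common≤1 {c} {c'} c∈K c'∈K c≢c' with length (common (corners c) (corners c')) ≤? 1
    ... | yes ≤1 = ≤1
    ... | no ≰1 with unique-distinct-pair (common-unique {corners c} (corners-unique (K-valid c'∈K))) (≰⇒> ≰1)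
    ...   | u , v , u∈ , v∈ , u≢v
      with ∈-filter⁻ (_∈? corners c) {xs = corners c'} u∈ | ∈-filter⁻ (_∈? corners c) {xs = corners c'} v∈
    ...     | u∈c' , u∈c | v∈c' , v∈c = ⊥-elim (c≢c' (cong proj₁ (shared-pair⇒same-code (K-valid c∈K) (K-valid c'∈K) u≢v
      (∈-corners⁻ u∈c) (∈-corners⁻ v∈c) (∈-corners⁻ u∈c') (∈-corners⁻ v∈c'))))

    extend : ∀ {T ts} → T ∉ ts → Span ts → Piece T → Span (T ∷ ts)
    extend T∉ts (none k≡0) (none kT≡0) = none (trans (length-K-on-∷ T∉ts) (cong₂ _+_ kT≡0 k≡0))
    extend T∉ts (one c∈K c∈ts k≡1) (none kT≡0) = one c∈K (there c∈ts) (trans (length-K-on-∷ T∉ts) (cong₂ _+_ kT≡0 k≡1))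
    extend {T} {ts} T∉ts (many W-unique W⊆S W-owned bound) (none kT≡0) =
      many W-unique W⊆S (λ w∈ o → there (W-owned w∈ o))
        (subst (λ k → k + 3 ≤ _) (sym (trans (length-K-on-∷ T∉ts) (cong (_+ length (K-on ts)) kT≡0))) bound)
    extend T∉ts (none k≡0) (one c∈K c≡T kT≡1) = one c∈K (here c≡T) (trans (length-K-on-∷ T∉ts) (cong₂ _+_ kT≡1 k≡0))
    extend {T} T∉ts (none k≡0) (many verts@(X-unique , X⊆S , _) bound) =
      many X-unique X⊆S (λ w∈ o → case sphere-OfSphere verts w∈ of λ
          { (inj₁ o') → here (just-injective (trans (sym o) o')) ; (inj₂ unowned) → case trans (sym o) unowned of λ () })
        (subst (λ k → k + 3 ≤ _) (sym (trans (length-K-on-∷ T∉ts) (trans (cong (_ +_) k≡0) (+-identityʳ _)))) bound)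
    extend T∉ts (one {c₁} c₁∈K c₁∈ts k≡1) (one {c} c∈K c≡T kT≡1) =
      merge {e = 2} {e' = 2} T∉ts (corners-unique (K-valid c₁∈K)) (corners-⊆ c₁∈K) (corners-OwnedIn c₁∈K c₁∈ts)
        (corners-unique (K-valid c∈K)) (corners-⊆ c∈K) (subst (λ T → OfSphere T _) c≡T (corners-OfSphere (K-valid c∈K)))
        (≤-reflexive (cong (_+ 2) k≡1)) (≤-reflexive (cong (_+ 2) kT≡1))
        (corners-common≤1 c₁∈K c∈K (λ c₁≡c → T∉ts (subst (_∈ _) (trans c₁≡c c≡T) c₁∈ts))) ≤-refl
    extend T∉ts (many W-unique W⊆S W-owned bound) (one {c} c∈K c≡T kT≡1) =
      merge {e = 3} {e' = 2} T∉ts W-unique W⊆S W-owned (corners-unique (K-valid c∈K)) (corners-⊆ c∈K) X-of-T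
        bound (≤-reflexive (cong (_+ 2) kT≡1))
        (≤-trans (proj₂ (common≤olds T∉ts W-owned (corners-unique (K-valid c∈K)) X-of-T)) (corners-olds (K-valid c∈K))) ≤-refl
      where X-of-T = subst (λ T → OfSphere T _) c≡T (corners-OfSphere (K-valid c∈K))
    extend T∉ts (one {c₁} c₁∈K c₁∈ts k≡1) (many verts@(X-unique , X⊆S , _) bound) =
      merge {e = 2} {e' = 3} T∉ts (corners-unique (K-valid c₁∈K)) (corners-⊆ c₁∈K) (corners-OwnedIn c₁∈K c₁∈ts)
        X-unique X⊆S (sphere-OfSphere verts) (≤-reflexive (cong (_+ 2) k≡1)) bound
        (≤-trans (proj₁ (common≤olds T∉ts (corners-OwnedIn c₁∈K c₁∈ts) X-unique (sphere-OfSphere verts)))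
          (corners-olds (K-valid c₁∈K))) ≤-refl
    extend T∉ts (many W-unique W⊆S W-owned bound) (many verts@(X-unique , X⊆S , _) bound') =
      merge {e = 3} {e' = 3} T∉ts W-unique W⊆S W-owned X-unique X⊆S (sphere-OfSphere verts) bound bound'
        (≤-trans (proj₂ (common≤olds T∉ts W-owned X-unique (sphere-OfSphere verts))) (sphere-olds verts)) ≤-refl

    span : ∀ ts → Unique ts → Span ts
    span [] _ = none (cong length (filter-none (λ c → proj₁ c ∈ₜ? []) {xs = K} (All.tabulate λ _ ())))
    span (T ∷ ts) (T∉ts ∷ ts-unique) = extend (λ T∈ → All.lookup T∉ts T∈ refl) (span ts ts-unique) (piece T)

    length-K-on-all : length (K-on allTriples) ≡ length K
    length-K-on-all =
      cong length (filter-all (λ c → proj₁ c ∈ₜ? allTriples) {xs = K} (All.tabulate λ {c} _ → ∈-allTriples (proj₁ c)))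

    vertex-bound : 2 ≤ length K → length K + 3 ≤ length S
    vertex-bound 2≤ with span allTriples allTriples-unique
    ... | none k≡0 with () ← subst (2 ≤_) (trans (sym length-K-on-all) k≡0) 2≤
    ... | one _ _ k≡1 with s≤s () ← subst (2 ≤_) (trans (sym length-K-on-all) k≡1) 2≤
    ... | many W-unique W⊆S _ bound =
      ≤-trans (subst (λ k → k + 3 ≤ _) length-K-on-all bound) (unique-⊆⇒length-≤ W-unique W⊆S)

  D-girth : GirthGreaterThan g D
  D-girth S _ 4≤|S| |S|≤g I I-unique |S|≤|I|+2 I⊆S =
    3≰2 (+-cancelˡ-≤ (length K) 3 2 (≤-trans bound (subst (λ k → length S ≤ k + 2) (sym |K|) |S|≤|I|+2)))
    where
    3≰2 : ¬ 3 ≤ 2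
    3≰2 (s≤s (s≤s ()))
    code : Fin (length D) → Code
    code i = proj₁ (decode i)
    K = map code I
    |K| : length K ≡ length I
    |K| = length-map code I
    K-valid : ∀ {c} → c ∈ K → Valid c
    K-valid c∈ with ∈-map⁻ code c∈
    ... | i , _ , refl = proj₁ (proj₂ (decode i))
    K-in-S : ∀ {c} → c ∈ K → ∀ {w} → w ∈T ▵ c → w ∈ S
    K-in-S c∈ w∈ with ∈-map⁻ code c∈
    ... | i , i∈I , refl = ⊆T-∈ (lookup D i) (All.lookup I⊆S i∈I) (subst (_ ∈T_) (sym (proj₂ (proj₂ (decode i)))) w∈)
    K-unique : Unique K
    K-unique = unique-map⁺ code (λ {i} {j} _ _ same → unique-lookup-injective D-unique i j
      (trans (proj₂ (proj₂ (decode i))) (trans (cong ▵ same) (sym (proj₂ (proj₂ (decode j))))))) I-unique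
    2≤|K| : 2 ≤ length K
    2≤|K| = subst (2 ≤_) (sym |K|) (+-cancelʳ-≤ 2 2 (length I) (≤-trans 4≤|S| |S|≤|I|+2))
    bound : length K + 3 ≤ length S
    bound = SpanBound.vertex-bound S |S|≤g K K-unique K-valid K-in-S 2≤|K|

lemma4p10 : (n g : ℕ) → 3 ≤ g
    → (lab : Triple n → Fin n × Fin n × Fin n)
    → (∀ T → IsLabelling (proj₁ T) (lab T))
    → (L : SimpleGraph (Fin n))
    → TriangleDecomposable (SimpleGraph.Adj L)
    → Σ (List (Tri (V n g))) λ D →
        IsTriangleDecomposition (Sphere.UnionE n g lab L) D
        × All (Sphere.InC n g lab) D
        × GirthGreaterThan g D
lemma4p10 n (suc (suc (suc h))) (s≤s (s≤s (s≤s z≤n))) lab lab-ok L (DL , DL-ok) =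
  D , D-decomposition , D-in-C , D-girth
  where
  open Construction n h lab lab-ok L DL DL-ok
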